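{- Let $r_1,r_2$ be positive integers, $r=r_1+r_2$, and let $q,Q$ be indeterminates. For every double partition $(\alpha,\beta)$, $$W_{(\alpha,\beta)}(q,Q)=\sum_{(\gamma,\eta)}W_{(\gamma,\eta)}(q,Q),$$ where the sum runs over all double partitions $(\gamma,\eta)$ obtained from $(\alpha,\beta)$ by adding one box (to either $\alpha$ or $\beta$).
   Context: A double partition $(\alpha,\beta)$ of $n$ is an ordered pair of partitions with $|\alpha|+|\beta|=n$. For a partition $\alpha$ and $k\ge1$, $s_\alpha(x_1,\dots,x_k)$ denotes the Schur polynomial (zero if $\alpha$ has more than $k$ nonzero parts); for $\ell(\alpha)\le k$, $s_\alpha(1,q,\dots,q^{k-1})=q^{n(\alpha)}\prod_{1\le i<j\le k}\frac{1-q^{\alpha_i-\alpha_j+j-i}}{1-q^{j-i}}$ with $n(\alpha)=\sum_i(i-1)\alpha_i$. Define (with $\alpha_i=0$ for $i>\ell(\alpha)$, $\beta_j=0$ for $j>\ell(\beta)$) $$W_{(\alpha,\beta)}(q,Q)=q^{r_1|\beta|}\frac{s_\alpha(1,q,\dots,q^{r_1-1})\,s_\beta(1,q,\dots,q^{r_2-1})}{\left(\frac{1-q^{r}}{1-q}\right)^{|\alpha|+|\beta|}}\prod_{i=1}^{r_1}\prod_{j=1}^{r_2}\frac{1+Qq^{\alpha_i-\beta_j+j-i}}{1+Qq^{j-i}}.$$ When $\ell(\alpha)\le r_1$ and $\ell(\beta)\le r_2$ this equals $q^{n(\alpha)+n(\beta)}\left(\frac{1-q}{1-q^r}\right)^{|\alpha|+|\beta|}\prod_{1\le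 i<j\le r_1}\frac{1-q^{\alpha_i-\alpha_j+j-i}}{1-q^{j-i}}\prod_{1\le i<j\le r_2}\frac{1-q^{\beta_i-\beta_j+j-i}}{1-q^{j-i}}\prod_{i=1}^{r_1}\prod_{j=1}^{r_2}\frac{Qq^{\alpha_i-i}+q^{\beta_j-j}}{Qq^{ -i}+q^{ -j}}$. -}

module Defs where

open import Data.Nat as ℕ using (ℕ; zero; suc; _<ᵇ_; _≡ᵇ_)
open import Data.Integer as ℤ using (ℤ; +_; -[1+_])
open import Data.Rational as ℚ using (ℚ; 0ℚ; 1ℚ; _+_; _*_; _-_; 1/_; _≟_; ≢-nonZero)
open import Data.List as L using (List; []; _∷_; length; map; _++_; upTo; filterᵇ; foldr)
open import Data.Nat.ListAction using (sum)
open import Data.List.Relation.Unary.Linked using (Linked)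
open import Data.List.Relation.Unary.All using (All)
open import Data.Product using (_×_; _,_)
open import Data.Bool using (Bool; true; false; if_then_else_; _∨_)
open import Relation.Nullary using (yes; no)

IsPartition : List ℕ → Set
IsPartition α = Linked ℕ._≥_ α × All (λ a → 0 ℕ.< a) α

IsDoublePartition : List ℕ × List ℕ → Set
IsDoublePartition (α , β) = IsPartition α × IsPartition β

size : List ℕ → ℕ
size = sum

-- α_i, 1-indexed, with α_i = 0 for i > ℓ(α) (and for i = 0)
part : List ℕ → ℕ → ℕ
part []       _             = 0
part (a ∷ as) zero          = 0
part (a ∷ as) (suc zero)    = a
part (a ∷ as) (suc (suc i)) = part as (suc i)

nfun : List ℕ → ℕ
nfun α = sum (map (λ i → i ℕ.* part α (suc i)) (upTo (length α)))

-- increment the (1-indexed) i-th part (appending a new part 1 if i = ℓ+1)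
incAt : List ℕ → ℕ → List ℕ
incAt []       _             = 1 ∷ []
incAt (a ∷ as) zero          = a ∷ as
incAt (a ∷ as) (suc zero)    = suc a ∷ as
incAt (a ∷ as) (suc (suc i)) = a ∷ incAt as (suc i)

canAdd : List ℕ → ℕ → Bool
canAdd α zero          = false
canAdd α (suc zero)    = true
canAdd α (suc (suc i)) = part α (suc (suc i)) <ᵇ part α (suc i)

addBox : List ℕ → List (List ℕ)
addBox α = map (incAt α) (filterᵇ (canAdd α) (map suc (upTo (suc (length α)))))

addBox₂ : List ℕ × List ℕ → List (List ℕ × List ℕ)
addBox₂ (α , β) = map (λ γ → (γ , β)) (addBox α) ++ map (λ η → (α , η)) (addBox β)

-- total inverse (inv 0 = 0); only used at arguments assumed nonzero
inv : ℚ → ℚ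
inv x with x ≟ 0ℚ
... | yes _  = 0ℚ
... | no x≢0 = 1/_ x {{≢-nonZero x≢0}}

_^ℕ_ : ℚ → ℕ → ℚ
x ^ℕ zero  = 1ℚ
x ^ℕ suc n = x * (x ^ℕ n)

_^ℤ_ : ℚ → ℤ → ℚ
x ^ℤ (+ n)     = x ^ℕ n
x ^ℤ -[1+ n ]  = inv (x ^ℕ suc n)

prodTo : ℕ → (ℕ → ℚ) → ℚ
prodTo k f = foldr _*_ 1ℚ (map (λ i → f (suc i)) (upTo k))

prodPairs : ℕ → (ℕ → ℕ → ℚ) → ℚ
prodPairs k f = prodTo k (λ j → prodTo (j ℕ.∸ 1) (λ i → f i j))

-- integer a - b + c - d  (used for exponents like α_i - β_j + j - i)
ex : ℕ → ℕ → ℕ → ℕ → ℤ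
ex a b c d = ((+ a) ℤ.- (+ b)) ℤ.+ ((+ c) ℤ.- (+ d))

-- Principal specialisation s_α(1,q,…,q^{k-1}) (zero if ℓ(α) > k).

schurPS : ℚ → List ℕ → ℕ → ℚ
schurPS q α k =
  if k <ᵇ length α then 0ℚ
  else (q ^ℕ nfun α) *
       prodPairs k (λ i j → (1ℚ - q ^ℤ ex (part α i) (part α j) j i)
                            * inv (1ℚ - q ^ℤ ex 0 0 j i))

W : ℕ → ℕ → ℚ → ℚ → List ℕ × List ℕ → ℚ
W r₁ r₂ q Q (α , β) =
  (q ^ℕ (r₁ ℕ.* size β))
  * schurPS q α r₁ * schurPS q β r₂
  * inv (((1ℚ - q ^ℕ r) * inv (1ℚ - q)) ^ℕ (size α ℕ.+ size β))
  * prodTo r₁ (λ i → prodTo r₂ (λ j →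
      (1ℚ + Q * q ^ℤ ex (part α i) (part β j) j i)
      * inv (1ℚ + Q * q ^ℤ ex 0 0 j i)))
  where r = r₁ ℕ.+ r₂

sumℚ : List ℚ → ℚ
sumℚ = foldr _+_ 0ℚ

{-# OPTIONS --safe #-}
module Submission where

-- Write x_i = q^(α_i − i) and y_j = q^(β_j − j). If ℓ(α) ≤ r₁ and ℓ(β) ≤ r₂ then
-- W(α, β) = c · [r]_q^−(|α|+|β|) · Δ₂(x, y) with c independent of α and β, where
-- Δ₂(x, y) = Δ(x) Δ(y) ∏_{i,j} (y_j + Q x_i) and Δ is the Vandermonde product.
-- Adding a box in row i replaces x_i by q x_i, and where no box can be added q x_i = x_{i−1},
-- so Δ vanishes; hence the right-hand side is c · [r]_q^−(|α|+|β|+1) times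
-- Σ_i Δ₂(x with x_i ↦ q x_i, y) + Σ_j Δ₂(x, y with y_j ↦ q y_j).
-- For one Vandermonde product, Σ_m Δ(x with x_m ↦ q x_m) = [k]_q Δ(x). Applied to the
-- concatenation of −Q·x and y, whose Vandermonde product is Δ₂(x, y) times a factor that is
-- nonzero when Q ≠ 0, it shows that the sum above is [r]_q Δ₂(x, y); for Q = 0 the two blocks
-- separate and [r₂ + r₁]_q = [r₁]_q + q^r₁ [r₂]_q. If ℓ(α) > r₁ or ℓ(β) > r₂ every term is 0.

open import Defs
open import Algebra.Bundles using (CommutativeSemigroup)
open import Algebra.Structures using (IsCommutativeMonoid)
open import Data.Bool using (true; false; if_then_else_; T)
open import Data.Empty using (⊥-elim)
open import Data.Integer as ℤ using (ℤ; _⊖_)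
import Data.Integer.Properties as ℤₚ
import Data.Integer.Tactic.RingSolver as ℤ-Solver
open import Data.List using (List; []; _∷_; length; map; _++_; upTo; applyUpTo; filterᵇ; foldr)
import Data.List.Properties as Listₚ
open import Data.List.Relation.Unary.Linked using (Linked; []; [-]; _∷_)
open import Data.Nat as ℕ using (ℕ; zero; suc; _≤_; _<_; _≤′_; z≤n; s≤s; _∸_)
open import Data.Nat.ListAction using (sum)
import Data.Nat.Properties as ℕₚ
open import Data.Product using (_×_; _,_)
open import Data.Rational using (ℚ; 0ℚ; 1ℚ; _+_; _*_; _-_; -_; _≟_; ≢-nonZero)
import Data.Rational.Properties as ℚₚ
open import Data.Sum using (_⊎_; inj₁; inj₂; [_,_]′)
open import Level using (0ℓ)
open import Relation.Binary.PropositionalEquality hiding ([_])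
open import Relation.Nullary using (Dec; yes; no; ¬_)
open import Relation.Nullary.Decidable.Core using (dec⇒maybe)
open import Tactic.RingSolver using (solve-∀)
open import Tactic.RingSolver.Core.AlmostCommutativeRing
  using (AlmostCommutativeRing; fromCommutativeRing)

open ≡-Reasoning

ℚ-ring : AlmostCommutativeRing 0ℓ 0ℓ
ℚ-ring = fromCommutativeRing ℚₚ.+-*-commutativeRing (λ x → dec⇒maybe (0ℚ ≟ x))

inv-inverseʳ : ∀ {x} → x ≢ 0ℚ → x * inv x ≡ 1ℚ
inv-inverseʳ {x} x≢0 with x ≟ 0ℚ
... | yes x≡0 = ⊥-elim (x≢0 x≡0)
... | no x≢0′ = ℚₚ.*-inverseʳ x {{≢-nonZero x≢0′}}

inv-inverseˡ : ∀ {x} → x ≢ 0ℚ → inv x * x ≡ 1ℚ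
inv-inverseˡ {x} x≢0 = trans (ℚₚ.*-comm (inv x) x) (inv-inverseʳ x≢0)

*-cancelˡ : ∀ {c a b} → c ≢ 0ℚ → c * a ≡ c * b → a ≡ b
*-cancelˡ {c} {a} {b} c≢0 ca≡cb = begin
  a                ≡⟨ unit a ⟩
  inv c * (c * a)  ≡⟨ cong (inv c *_) ca≡cb ⟩
  inv c * (c * b)  ≡⟨ unit b ⟨
  b                ∎
  where
  unit : ∀ y → y ≡ inv c * (c * y)
  unit y = begin
    y                ≡⟨ ℚₚ.*-identityˡ y ⟨
    1ℚ * y           ≡⟨ cong (_* y) (inv-inverseˡ c≢0) ⟨
    inv c * c * y    ≡⟨ ℚₚ.*-assoc (inv c) c y ⟩
    inv c * (c * y)  ∎

*-≢0 : ∀ {x y} → x ≢ 0ℚ → y ≢ 0ℚ → x * y ≢ 0ℚ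
*-≢0 {x} {y} x≢0 y≢0 xy≡0 = y≢0 (*-cancelˡ x≢0 (trans xy≡0 (sym (ℚₚ.*-zeroʳ x))))

inv-unique : ∀ {x y} → x * y ≡ 1ℚ → inv x ≡ y
inv-unique {x} {y} xy≡1 = *-cancelˡ x≢0 (trans (inv-inverseʳ x≢0) (sym xy≡1))
  where
  x≢0 : x ≢ 0ℚ
  x≢0 refl = ℚₚ.1≢0 (trans (sym xy≡1) (ℚₚ.*-zeroˡ y))

inv-≢0 : ∀ {x} → x ≢ 0ℚ → inv x ≢ 0ℚ
inv-≢0 {x} x≢0 inv≡0 = ℚₚ.1≢0 (begin
  1ℚ          ≡⟨ inv-inverseʳ x≢0 ⟨
  x * inv x   ≡⟨ cong (x *_) inv≡0 ⟩
  x * 0ℚ      ≡⟨ ℚₚ.*-zeroʳ x ⟩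
  0ℚ          ∎)

inv-involutive : ∀ x → inv (inv x) ≡ x
inv-involutive x = cases (x ≟ 0ℚ)
  where
  cases : Dec (x ≡ 0ℚ) → inv (inv x) ≡ x
  cases (yes x≡0) = trans (cong (λ x → inv (inv x)) x≡0) (sym x≡0)
  cases (no x≢0)  = inv-unique {inv x} (inv-inverseˡ x≢0)

inv-distrib-* : ∀ x y → inv (x * y) ≡ inv x * inv y
inv-distrib-* x y = cases (x ≟ 0ℚ) (y ≟ 0ℚ)
  where
  interchange : ∀ a b c d → a * b * (c * d) ≡ a * c * (b * d)
  interchange = solve-∀ ℚ-ring
  cases : Dec (x ≡ 0ℚ) → Dec (y ≡ 0ℚ) → inv (x * y) ≡ inv x * inv y
  cases (yes x≡0) _ = begin
    inv (x * y)       ≡⟨ cong (λ x → inv (x * y)) x≡0 ⟩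
    inv (0ℚ * y)      ≡⟨ cong inv (ℚₚ.*-zeroˡ y) ⟩
    0ℚ                ≡⟨ ℚₚ.*-zeroˡ (inv y) ⟨
    0ℚ * inv y        ≡⟨ cong (λ x → inv x * inv y) x≡0 ⟨
    inv x * inv y     ∎
  cases (no _) (yes y≡0) = begin
    inv (x * y)       ≡⟨ cong (λ y → inv (x * y)) y≡0 ⟩
    inv (x * 0ℚ)      ≡⟨ cong inv (ℚₚ.*-zeroʳ x) ⟩
    0ℚ                ≡⟨ ℚₚ.*-zeroʳ (inv x) ⟨
    inv x * 0ℚ        ≡⟨ cong (λ y → inv x * inv y) y≡0 ⟨
    inv x * inv y     ∎
  cases (no x≢0) (no y≢0) = inv-unique {x * y} (begin
    x * y * (inv x * inv y)    ≡⟨ interchange x y (inv x) (inv y) ⟩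
    x * inv x * (y * inv y)    ≡⟨ cong₂ _*_ (inv-inverseʳ x≢0) (inv-inverseʳ y≢0) ⟩
    1ℚ                         ∎)

^-distribˡ-+-* : ∀ x m n → x ^ℕ (m ℕ.+ n) ≡ x ^ℕ m * x ^ℕ n
^-distribˡ-+-* x zero    n = sym (ℚₚ.*-identityˡ _)
^-distribˡ-+-* x (suc m) n =
  trans (cong (x *_) (^-distribˡ-+-* x m n)) (sym (ℚₚ.*-assoc x _ _))

^-distribʳ-* : ∀ x y n → (x * y) ^ℕ n ≡ x ^ℕ n * y ^ℕ n
^-distribʳ-* x y zero    = refl
^-distribʳ-* x y (suc n) =
  trans (cong (x * y *_) (^-distribʳ-* x y n)) (interchange x y _ _)
  where
  interchange : ∀ a b c d → a * b * (c * d) ≡ a * c * (b * d)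
  interchange = solve-∀ ℚ-ring

^-*-assoc : ∀ x m n → (x ^ℕ m) ^ℕ n ≡ x ^ℕ (m ℕ.* n)
^-*-assoc x m zero    = cong (x ^ℕ_) (sym (ℕₚ.*-zeroʳ m))
^-*-assoc x m (suc n) = begin
  x ^ℕ m * (x ^ℕ m) ^ℕ n        ≡⟨ cong (x ^ℕ m *_) (^-*-assoc x m n) ⟩
  x ^ℕ m * x ^ℕ (m ℕ.* n)       ≡⟨ ^-distribˡ-+-* x m (m ℕ.* n) ⟨
  x ^ℕ (m ℕ.+ m ℕ.* n)          ≡⟨ cong (x ^ℕ_) (ℕₚ.*-suc m n) ⟨
  x ^ℕ (m ℕ.* suc n)            ∎

^-≢0 : ∀ {x} n → x ≢ 0ℚ → x ^ℕ n ≢ 0ℚ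
^-≢0 zero    x≢0 = ℚₚ.1≢0
^-≢0 (suc n) x≢0 = *-≢0 x≢0 (^-≢0 n x≢0)

_∈[1,_] : ℕ → ℕ → Set
i ∈[1, k ] = 1 ≤ i × i ≤ k

∈-weaken : ∀ {i k} → i ∈[1, k ] → i ∈[1, suc k ]
∈-weaken (1≤i , i≤k) = 1≤i , ℕₚ.m≤n⇒m≤1+n i≤k

∈-top : ∀ k → suc k ∈[1, suc k ]
∈-top k = s≤s z≤n , ℕₚ.≤-refl

if-T : ∀ {A : Set} b {x y : A} → T b → (if b then x else y) ≡ x
if-T true _ = refl

if-¬T : ∀ {A : Set} b {x y : A} → ¬ T b → (if b then x else y) ≡ y
if-¬T false _  = refl
if-¬T true  ¬t = ⊥-elim (¬t _)

-- Defined with ≡ᵇ rather than ≟ so that it computes on successor patterns (see part-incAt).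
update : {A : Set} → (ℕ → A) → ℕ → A → ℕ → A
update f m v i = if i ℕ.≡ᵇ m then v else f i

update-≡ : ∀ {A : Set} (f : ℕ → A) m v → update f m v m ≡ v
update-≡ f m v = if-T (m ℕ.≡ᵇ m) (ℕₚ.≡⇒≡ᵇ m m refl)

update-≢ : ∀ {A : Set} (f : ℕ → A) {m} v {i} → i ≢ m → update f m v i ≡ f i
update-≢ f {m} v {i} i≢m = if-¬T (i ℕ.≡ᵇ m) (λ t → i≢m (ℕₚ.≡ᵇ⇒≡ i m t))

update-cong : ∀ {A : Set} {f g : ℕ → A} m v → (∀ i → i ≢ m → f i ≡ g i) →
              ∀ i → update f m v i ≡ update g m v i
update-cong m v f≡g i with i ℕ.≡ᵇ m | ℕₚ.≡⇒≡ᵇ i m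
... | true  | _   = refl
... | false | i≢m = f≡g i i≢m

module BigOperator {A : Set} {_∙_ : A → A → A} {ε : A}
                   (isCommutativeMonoid : IsCommutativeMonoid _≡_ _∙_ ε) where

  open IsCommutativeMonoid isCommutativeMonoid
    using (assoc; comm; identityˡ; identityʳ; isCommutativeSemigroup)

  private
    semigroup : CommutativeSemigroup 0ℓ 0ℓ
    semigroup = record { isCommutativeSemigroup = isCommutativeSemigroup }

  open import Algebra.Properties.CommutativeSemigroup semigroup using (interchange)

  big : ℕ → (ℕ → A) → A
  big zero    f = ε
  big (suc k) f = big k f ∙ f (suc k)

  big-cong : ∀ k {f g} → (∀ i → i ∈[1, k ] → f i ≡ g i) → big k f ≡ big k g
  big-cong zero    f≡g = refl
  big-cong (suc k) f≡g =
    cong₂ _∙_ (big-cong k (λ i i∈ → f≡g i (∈-weaken i∈))) (f≡g (suc k) (∈-top k))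

  big-ε : ∀ k → big k (λ _ → ε) ≡ ε
  big-ε zero    = refl
  big-ε (suc k) = trans (identityʳ _) (big-ε k)

  big-distrib : ∀ k f g → big k (λ i → f i ∙ g i) ≡ big k f ∙ big k g
  big-distrib zero    f g = sym (identityˡ ε)
  big-distrib (suc k) f g =
    trans (cong (_∙ (f (suc k) ∙ g (suc k))) (big-distrib k f g))
          (interchange (big k f) (big k g) (f (suc k)) (g (suc k)))

  big-swap : ∀ a b (f : ℕ → ℕ → A) →
             big a (λ i → big b (f i)) ≡ big b (λ j → big a (λ i → f i j))
  big-swap zero    b f = sym (big-ε b)
  big-swap (suc a) b f =
    trans (cong (_∙ big b (f (suc a))) (big-swap a b f))
          (sym (big-distrib b (λ j → big a (λ i → f i j)) (f (suc a))))

  big-split : ∀ n m f → big (n ℕ.+ m) f ≡ big m f ∙ big n (λ i → f (i ℕ.+ m))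
  big-split zero    m f = sym (identityʳ _)
  big-split (suc n) m f =
    trans (cong (_∙ f (suc n ℕ.+ m)) (big-split n m f)) (assoc _ _ _)

  big-cons : ∀ k f → big (suc k) f ≡ f 1 ∙ big k (λ i → f (suc i))
  big-cons zero    f = trans (identityˡ (f 1)) (sym (identityʳ (f 1)))
  big-cons (suc k) f = trans (cong (_∙ f (suc (suc k))) (big-cons k f)) (assoc _ _ _)

  big-applyUpTo : ∀ n f → foldr _∙_ ε (applyUpTo (λ i → f (suc i)) n) ≡ big n f
  big-applyUpTo zero    f = refl
  big-applyUpTo (suc n) f =
    trans (cong (f 1 ∙_) (big-applyUpTo n (λ i → f (suc i)))) (sym (big-cons n f))

  big-extend : ∀ {k n} f → k ≤ n → (∀ i → k < i → f i ≡ ε) → big n f ≡ big k f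
  big-extend {k} f k≤n f≡ε = go (ℕₚ.≤⇒≤′ k≤n)
    where
    go : ∀ {n} → k ≤′ n → big n f ≡ big k f
    go (ℕ.≤′-reflexive refl) = refl
    go (ℕ.≤′-step {n} k≤′n) =
      trans (cong₂ _∙_ (go k≤′n) (f≡ε (suc n) (s≤s (ℕₚ.≤′⇒≤ k≤′n)))) (identityʳ _)

  big-supported : ∀ {m n} f → (∀ i → m < i → f i ≡ ε) → (∀ i → n < i → f i ≡ ε) →
                  big m f ≡ big n f
  big-supported {m} {n} f f≡εₘ f≡εₙ with ℕₚ.≤-total m n
  ... | inj₁ m≤n = sym (big-extend f m≤n f≡εₘ)
  ... | inj₂ n≤m = big-extend f n≤m f≡εₙ

  big-extract : ∀ k {m} f → m ∈[1, k ] → big k f ≡ big k (update f m ε) ∙ f m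
  big-extract zero    f (1≤m , m≤0) = ⊥-elim (ℕₚ.<⇒≱ 1≤m m≤0)
  big-extract (suc k) {m} f (1≤m , m≤1+k) with ℕₚ.m≤n⇒m<n∨m≡n m≤1+k
  ... | inj₂ refl = begin
    big k f ∙ f m                              ≡⟨ cong (_∙ f m) (big-cong k away) ⟩
    big k f′ ∙ f m                             ≡⟨ cong (_∙ f m) (identityʳ _) ⟨
    (big k f′ ∙ ε) ∙ f m                       ≡⟨ cong (λ e → (big k f′ ∙ e) ∙ f m) (update-≡ f m ε) ⟨
    (big k f′ ∙ f′ m) ∙ f m                    ∎
    where
    f′ = update f m ε
    away : ∀ i → i ∈[1, k ] → f i ≡ f′ i
    away i (_ , i≤k) = sym (update-≢ f ε (ℕₚ.<⇒≢ (s≤s i≤k)))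
  ... | inj₁ (s≤s m≤k) = begin
    big k f ∙ f (suc k)                        ≡⟨ cong (_∙ f (suc k)) (big-extract k f (1≤m , m≤k)) ⟩
    (big k f′ ∙ f m) ∙ f (suc k)               ≡⟨ assoc _ _ _ ⟩
    big k f′ ∙ (f m ∙ f (suc k))               ≡⟨ cong (big k f′ ∙_) (comm _ _) ⟩
    big k f′ ∙ (f (suc k) ∙ f m)               ≡⟨ assoc _ _ _ ⟨
    (big k f′ ∙ f (suc k)) ∙ f m               ≡⟨ cong (λ e → (big k f′ ∙ e) ∙ f m) m≢1+k ⟨
    (big k f′ ∙ f′ (suc k)) ∙ f m              ∎
    where
    f′ = update f m ε
    m≢1+k = update-≢ f ε (ℕₚ.>⇒≢ (s≤s m≤k))

open BigOperator ℚₚ.*-1-isCommutativeMonoid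
  renaming ( big to Π; big-cong to Π-cong; big-distrib to Π-distrib; big-swap to Π-swap
           ; big-split to Π-split; big-cons to Π-cons; big-applyUpTo to Π-applyUpTo
           ; big-extend to Π-extend; big-extract to Π-extract; big-ε to Π-1)
  using ()

open BigOperator ℚₚ.+-0-isCommutativeMonoid
  renaming ( big to Σ; big-cong to Σ-cong; big-distrib to Σ-distrib; big-split to Σ-split
           ; big-applyUpTo to Σ-applyUpTo; big-supported to Σ-supported; big-ε to Σ-0)
  using ()

Π-const : ∀ k c → Π k (λ _ → c) ≡ c ^ℕ k
Π-const zero    c = refl
Π-const (suc k) c = trans (cong (_* c) (Π-const k c)) (ℚₚ.*-comm _ c)

Π-zero : ∀ k {m} f → m ∈[1, k ] → f m ≡ 0ℚ → Π k f ≡ 0ℚ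
Π-zero k {m} f m∈ fm≡0 = begin
  Π k f                           ≡⟨ Π-extract k f m∈ ⟩
  Π k (update f m 1ℚ) * f m       ≡⟨ cong (Π k (update f m 1ℚ) *_) fm≡0 ⟩
  Π k (update f m 1ℚ) * 0ℚ        ≡⟨ ℚₚ.*-zeroʳ (Π k (update f m 1ℚ)) ⟩
  0ℚ                              ∎

Π-≢0 : ∀ k f → (∀ i → i ∈[1, k ] → f i ≢ 0ℚ) → Π k f ≢ 0ℚ
Π-≢0 zero    f f≢0 = ℚₚ.1≢0
Π-≢0 (suc k) f f≢0 = *-≢0 (Π-≢0 k f (λ i i∈ → f≢0 i (∈-weaken i∈))) (f≢0 (suc k) (∈-top k))

Π²-distrib : ∀ a b (f g : ℕ → ℕ → ℚ) →
  Π a (λ i → Π b (λ j → f i j * g i j)) ≡ Π a (λ i → Π b (f i)) * Π a (λ i → Π b (g i))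
Π²-distrib a b f g = trans (Π-cong a (λ i _ → Π-distrib b (f i) (g i))) (Π-distrib a _ _)

*-distribˡ-Σ : ∀ k c f → c * Σ k f ≡ Σ k (λ i → c * f i)
*-distribˡ-Σ zero    c f = ℚₚ.*-zeroʳ c
*-distribˡ-Σ (suc k) c f =
  trans (ℚₚ.*-distribˡ-+ c (Σ k f) (f (suc k))) (cong (_+ c * f (suc k)) (*-distribˡ-Σ k c f))

Σ-linear : ∀ k {f g h} a b → (∀ i → i ∈[1, k ] → f i ≡ a * g i + b * h i) →
           Σ k f ≡ a * Σ k g + b * Σ k h
Σ-linear k {f} {g} {h} a b f≡ = begin
  Σ k f                                       ≡⟨ Σ-cong k f≡ ⟩
  Σ k (λ i → a * g i + b * h i)               ≡⟨ Σ-distrib k _ _ ⟩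
  Σ k (λ i → a * g i) + Σ k (λ i → b * h i)   ≡⟨ cong₂ _+_ (*-distribˡ-Σ k a g) (*-distribˡ-Σ k b h) ⟨
  a * Σ k g + b * Σ k h                       ∎

prodTo-Π : ∀ k f → prodTo k f ≡ Π k f
prodTo-Π k f = trans (cong (foldr _*_ 1ℚ) (Listₚ.map-upTo (λ i → f (suc i)) k)) (Π-applyUpTo k f)

prodPairs-Π : ∀ k f → prodPairs k f ≡ Π k (λ j → Π (j ∸ 1) (λ i → f i j))
prodPairs-Π k f = trans (prodTo-Π k _) (Π-cong k (λ j _ → prodTo-Π (j ∸ 1) (λ i → f i j)))

ω : ℕ → (ℕ → ℚ) → ℚ → ℚ
ω k x t = Π k (λ i → t - x i)

ωExcept : ℕ → ℕ → (ℕ → ℚ) → ℚ → ℚ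
ωExcept k m x t = Π k (update (λ i → t - x i) m 1ℚ)

Δ : ℕ → (ℕ → ℚ) → ℚ
Δ k x = Π k (λ j → ω (j ∸ 1) x (x j))

ω-cong : ∀ k {x y} t → (∀ i → i ∈[1, k ] → x i ≡ y i) → ω k x t ≡ ω k y t
ω-cong k t x≡y = Π-cong k (λ i i∈ → cong (λ s → t - s) (x≡y i i∈))

ω-extract : ∀ k {m} x t → m ∈[1, k ] → ω k x t ≡ ωExcept k m x t * (t - x m)
ω-extract k x t = Π-extract k (λ i → t - x i)

ωExcept-suc : ∀ k {m} x t → m ≤ k → ωExcept (suc k) m x t ≡ ωExcept k m x t * (t - x (suc k))
ωExcept-suc k x t m≤k =
  cong (ωExcept k _ x t *_) (update-≢ (λ i → t - x i) 1ℚ (ℕₚ.>⇒≢ (s≤s m≤k)))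

ωExcept-top : ∀ k x t → ωExcept (suc k) (suc k) x t ≡ ω k x t
ωExcept-top k x t = begin
  ωExcept k (suc k) x t * update (λ i → t - x i) (suc k) 1ℚ (suc k)
    ≡⟨ cong₂ _*_ (Π-cong k (λ i (_ , i≤k) → update-≢ (λ i → t - x i) 1ℚ (ℕₚ.<⇒≢ (s≤s i≤k))))
                 (update-≡ (λ i → t - x i) (suc k) 1ℚ) ⟩
  ω k x t * 1ℚ
    ≡⟨ ℚₚ.*-identityʳ _ ⟩
  ω k x t ∎

Δ-cong : ∀ k {x y} → (∀ i → i ∈[1, k ] → x i ≡ y i) → Δ k x ≡ Δ k y
Δ-cong zero    x≡y = refl
Δ-cong (suc k) {x} {y} x≡y = cong₂ _*_ (Δ-cong k below) (begin
  ω k x (x (suc k))   ≡⟨ ω-cong k (x (suc k)) below ⟩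
  ω k y (x (suc k))   ≡⟨ cong (ω k y) (x≡y (suc k) (∈-top k)) ⟩
  ω k y (y (suc k))   ∎)
  where
  below : ∀ i → i ∈[1, k ] → _
  below i i∈ = x≡y i (∈-weaken i∈)

Δ-collision : ∀ k x {i j} → 1 ≤ i → i < j → j ≤ k → x i ≡ x j → Δ k x ≡ 0ℚ
Δ-collision k x {i} {suc j} 1≤i (s≤s i≤j) 1+j≤k xi≡xj =
  Π-zero k _ (s≤s z≤n , 1+j≤k)
    (Π-zero j _ (1≤i , i≤j) (trans (cong (_- x i) (sym xi≡xj)) (ℚₚ.+-inverseʳ (x i))))

_·_ : ℚ → (ℕ → ℚ) → ℕ → ℚ
(c · x) i = c * x i

ω-scale : ∀ k c x t → ω k (c · x) (c * t) ≡ c ^ℕ k * ω k x t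
ω-scale k c x t = begin
  Π k (λ i → c * t - c * x i)        ≡⟨ Π-cong k (λ i _ → factor c t (x i)) ⟩
  Π k (λ i → c * (t - x i))          ≡⟨ Π-distrib k (λ _ → c) (λ i → t - x i) ⟩
  Π k (λ _ → c) * ω k x t            ≡⟨ cong (_* ω k x t) (Π-const k c) ⟩
  c ^ℕ k * ω k x t                   ∎
  where
  factor : ∀ c t x → c * t - c * x ≡ c * (t - x)
  factor = solve-∀ ℚ-ring

Δ-scale : ∀ k c x → Δ k (c · x) ≡ Π k (λ j → c ^ℕ (j ∸ 1)) * Δ k x
Δ-scale zero    c x = sym (ℚₚ.*-identityˡ 1ℚ)
Δ-scale (suc k) c x = begin
  Δ k (c · x) * ω k (c · x) (c * x (suc k))
    ≡⟨ cong₂ _*_ (Δ-scale k c x) (ω-scale k c x (x (suc k))) ⟩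
  Π k (λ j → c ^ℕ (j ∸ 1)) * Δ k x * (c ^ℕ k * ω k x (x (suc k)))
    ≡⟨ interchange (Π k (λ j → c ^ℕ (j ∸ 1))) (Δ k x) (c ^ℕ k) (ω k x (x (suc k))) ⟩
  Π k (λ j → c ^ℕ (j ∸ 1)) * c ^ℕ k * (Δ k x * ω k x (x (suc k)))
    ∎
  where
  interchange : ∀ a b c d → a * b * (c * d) ≡ a * c * (b * d)
  interchange = solve-∀ ℚ-ring

join : ℕ → (ℕ → ℚ) → (ℕ → ℚ) → ℕ → ℚ
join m x y i with i ℕ.≤? m
... | yes _ = x i
... | no  _ = y (i ∸ m)

join-≤ : ∀ {m} x y {i} → i ≤ m → join m x y i ≡ x i
join-≤ {m} x y {i} i≤m with i ℕ.≤? m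
... | yes _   = refl
... | no  i≰m = ⊥-elim (i≰m i≤m)

join-> : ∀ {m} x y {i} → m < i → join m x y i ≡ y (i ∸ m)
join-> {m} x y {i} m<i with i ℕ.≤? m
... | yes i≤m = ⊥-elim (ℕₚ.<⇒≱ m<i i≤m)
... | no  _   = refl

join-+ : ∀ {m} x y {j} → 1 ≤ j → join m x y (j ℕ.+ m) ≡ y j
join-+ {m} x y {j} 1≤j =
  trans (join-> x y (ℕₚ.m<n+m m 1≤j)) (cong y (ℕₚ.m+n∸n≡m j m))

join-congˡ : ∀ m {x x′} y k → x k ≡ x′ k → join m x y k ≡ join m x′ y k
join-congˡ m y k xk≡x′k with k ℕ.≤? m
... | yes _ = xk≡x′k
... | no  _ = refl

join-congʳ : ∀ m x {y y′} k → (m < k → y (k ∸ m) ≡ y′ (k ∸ m)) → join m x y k ≡ join m x y′ k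
join-congʳ m x k y≡y′ with k ℕ.≤? m
... | yes _   = refl
... | no  k≰m = y≡y′ (ℕₚ.≰⇒> k≰m)

join-update-low : ∀ {m i} x y v → i ≤ m → ∀ k → update (join m x y) i v k ≡ join m (update x i v) y k
join-update-low {m} {i} x y v i≤m k = cases (k ℕ.≟ i)
  where
  cases : Dec (k ≡ i) → update (join m x y) i v k ≡ join m (update x i v) y k
  cases (yes refl) = trans (update-≡ (join m x y) k v)
                           (sym (trans (join-≤ (update x k v) y i≤m) (update-≡ x k v)))
  cases (no k≢i)   = trans (update-≢ (join m x y) v k≢i)
                           (join-congˡ m {x} {update x i v} y k (sym (update-≢ x v k≢i)))

join-update-high : ∀ {m j} x y v → 1 ≤ j → ∀ k →
                   update (join m x y) (j ℕ.+ m) v k ≡ join m x (update y j v) k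
join-update-high {m} {j} x y v 1≤j k = cases (k ℕ.≟ j ℕ.+ m)
  where
  cases : Dec (k ≡ j ℕ.+ m) → update (join m x y) (j ℕ.+ m) v k ≡ join m x (update y j v) k
  cases (yes refl) = trans (update-≡ (join m x y) k v)
                           (sym (trans (join-+ {m} x (update y j v) 1≤j) (update-≡ y j v)))
  cases (no k≢j+m) = trans (update-≢ (join m x y) v k≢j+m)
                           (join-congʳ m x {y} {update y j v} k (λ m<k → sym (update-≢ y v (k∸m≢j m<k))))
    where
    k∸m≢j : m < k → k ∸ m ≢ j
    k∸m≢j m<k k∸m≡j = k≢j+m (trans (sym (ℕₚ.m∸n+n≡m (ℕₚ.<⇒≤ m<k))) (cong (ℕ._+ m) k∸m≡j))

ω-join : ∀ j m x y t → ω (j ℕ.+ m) (join m x y) t ≡ ω m x t * ω j y t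
ω-join j m x y t = begin
  ω (j ℕ.+ m) (join m x y) t
    ≡⟨ Π-split j m (λ i → t - join m x y i) ⟩
  ω m (join m x y) t * Π j (λ i → t - join m x y (i ℕ.+ m))
    ≡⟨ cong₂ _*_ (ω-cong m t (λ i (_ , i≤m) → join-≤ x y i≤m))
                 (Π-cong j (λ i (1≤i , _) → cong (λ s → t - s) (join-+ x y 1≤i))) ⟩
  ω m x t * ω j y t
    ∎

Δ-join : ∀ n m x y → Δ (n ℕ.+ m) (join m x y) ≡ Δ m x * Π n (λ j → ω m x (y j)) * Δ n y
Δ-join n m x y = begin
  Δ (n ℕ.+ m) z
    ≡⟨ Π-split n m (λ j → ω (j ∸ 1) z (z j)) ⟩
  Δ m z * Π n (λ j → ω (j ℕ.+ m ∸ 1) z (z (j ℕ.+ m)))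
    ≡⟨ cong₂ _*_ (Δ-cong m (λ i (_ , i≤m) → join-≤ x y i≤m)) (Π-cong n column) ⟩
  Δ m x * Π n (λ j → ω m x (y j) * ω (j ∸ 1) y (y j))
    ≡⟨ cong (Δ m x *_) (Π-distrib n (λ j → ω m x (y j)) (λ j → ω (j ∸ 1) y (y j))) ⟩
  Δ m x * (Π n (λ j → ω m x (y j)) * Δ n y)
    ≡⟨ ℚₚ.*-assoc (Δ m x) (Π n (λ j → ω m x (y j))) (Δ n y) ⟨
  Δ m x * Π n (λ j → ω m x (y j)) * Δ n y
    ∎
  where
  z = join m x y
  column : ∀ j → j ∈[1, n ] → ω (j ℕ.+ m ∸ 1) z (z (j ℕ.+ m)) ≡ ω m x (y j) * ω (j ∸ 1) y (y j)
  column (suc j) (1≤j , _) = begin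
    ω (j ℕ.+ m) z (z (suc j ℕ.+ m))    ≡⟨ cong (ω (j ℕ.+ m) z) (join-+ {m} x y 1≤j) ⟩
    ω (j ℕ.+ m) z (y (suc j))          ≡⟨ ω-join j m x y (y (suc j)) ⟩
    ω m x (y (suc j)) * ω j y (y (suc j)) ∎

-- The q-shift identity for Vandermonde products

[_]_ : ℕ → ℚ → ℚ
[ zero  ] q = 0ℚ
[ suc k ] q = [ k ] q + q ^ℕ k

module _ (q : ℚ) where

  qShift : ℕ → (ℕ → ℚ) → ℕ → ℚ
  qShift m x = update x m (q * x m)

  qShift-≡ : ∀ m x → qShift m x m ≡ q * x m
  qShift-≡ m x = update-≡ x m (q * x m)

  qShift-≢ : ∀ {m} x {i} → i ≢ m → qShift m x i ≡ x i
  qShift-≢ {m} x = update-≢ x (q * x m)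

  qInt-+ : ∀ n m → [ n ℕ.+ m ] q ≡ [ m ] q + q ^ℕ m * [ n ] q
  qInt-+ zero    m = sym (trans (cong ([ m ] q +_) (ℚₚ.*-zeroʳ (q ^ℕ m))) (ℚₚ.+-identityʳ ([ m ] q)))
  qInt-+ (suc n) m = begin
    [ n ℕ.+ m ] q + q ^ℕ (n ℕ.+ m)                  ≡⟨ cong₂ _+_ (qInt-+ n m) (^-distribˡ-+-* q n m) ⟩
    [ m ] q + q ^ℕ m * [ n ] q + q ^ℕ n * q ^ℕ m     ≡⟨ collect ([ m ] q) (q ^ℕ m) ([ n ] q) (q ^ℕ n) ⟩
    [ m ] q + q ^ℕ m * ([ n ] q + q ^ℕ n)            ∎
    where
    collect : ∀ a b c d → a + b * c + d * b ≡ a + b * (c + d)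
    collect = solve-∀ ℚ-ring

  qInt-geometric : ∀ k → [ k ] q * (1ℚ - q) ≡ 1ℚ - q ^ℕ k
  qInt-geometric zero    = ℚₚ.*-zeroˡ (1ℚ - q)
  qInt-geometric (suc k) = begin
    ([ k ] q + q ^ℕ k) * (1ℚ - q)              ≡⟨ ℚₚ.*-distribʳ-+ (1ℚ - q) ([ k ] q) (q ^ℕ k) ⟩
    [ k ] q * (1ℚ - q) + q ^ℕ k * (1ℚ - q)     ≡⟨ cong (_+ q ^ℕ k * (1ℚ - q)) (qInt-geometric k) ⟩
    1ℚ - q ^ℕ k + q ^ℕ k * (1ℚ - q)           ≡⟨ telescope q (q ^ℕ k) ⟩
    1ℚ - q * q ^ℕ k                           ∎
    where
    telescope : ∀ q a → 1ℚ - a + a * (1ℚ - q) ≡ 1ℚ - q * a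
    telescope = solve-∀ ℚ-ring

  qInt-inverse : ∀ k → q ^ℕ k ≢ 1ℚ → inv ((1ℚ - q ^ℕ k) * inv (1ℚ - q)) * [ k ] q ≡ 1ℚ
  qInt-inverse k q^k≢1 = begin
    inv ((1ℚ - q ^ℕ k) * inv (1ℚ - q)) * [ k ] q
      ≡⟨ cong (_* ([ k ] q)) (inv-distrib-* (1ℚ - q ^ℕ k) (inv (1ℚ - q))) ⟩
    inv (1ℚ - q ^ℕ k) * inv (inv (1ℚ - q)) * [ k ] q
      ≡⟨ cong (λ c → inv (1ℚ - q ^ℕ k) * c * [ k ] q) (inv-involutive (1ℚ - q)) ⟩
    inv (1ℚ - q ^ℕ k) * (1ℚ - q) * [ k ] q
      ≡⟨ rotate (inv (1ℚ - q ^ℕ k)) (1ℚ - q) ([ k ] q) ⟩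
    inv (1ℚ - q ^ℕ k) * ([ k ] q * (1ℚ - q))
      ≡⟨ cong (inv (1ℚ - q ^ℕ k) *_) (qInt-geometric k) ⟩
    inv (1ℚ - q ^ℕ k) * (1ℚ - q ^ℕ k)
      ≡⟨ inv-inverseˡ 1-q^k≢0 ⟩
    1ℚ ∎
    where
    rotate : ∀ a b c → a * b * c ≡ a * (c * b)
    rotate = solve-∀ ℚ-ring
    1-q^k≢0 : 1ℚ - q ^ℕ k ≢ 0ℚ
    1-q^k≢0 1-q^k≡0 = q^k≢1 (begin
      q ^ℕ k                    ≡⟨ complement (q ^ℕ k) ⟩
      1ℚ - (1ℚ - q ^ℕ k)        ≡⟨ cong (λ a → 1ℚ - a) 1-q^k≡0 ⟩
      1ℚ                        ∎)
      where
      complement : ∀ a → a ≡ 1ℚ - (1ℚ - a)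
      complement = solve-∀ ℚ-ring

  Π-qShift : ∀ k {m} y → m ∈[1, k ] → Π k (qShift m y) ≡ q * Π k y
  Π-qShift k {m} y m∈ = begin
    Π k (qShift m y)                        ≡⟨ Π-extract k (qShift m y) m∈ ⟩
    Π k (update (qShift m y) m 1ℚ) * qShift m y m
      ≡⟨ cong₂ _*_ (Π-cong k (λ i _ → update-cong m 1ℚ (λ i i≢m → qShift-≢ y i≢m) i)) (qShift-≡ m y) ⟩
    Π k (update y m 1ℚ) * (q * y m)          ≡⟨ swap (Π k (update y m 1ℚ)) q (y m) ⟩
    q * (Π k (update y m 1ℚ) * y m)          ≡⟨ cong (q *_) (Π-extract k y m∈) ⟨
    q * Π k y                                ∎
    where
    swap : ∀ a b c → a * (b * c) ≡ b * (a * c)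
    swap = solve-∀ ℚ-ring

  Δ-qShift-top : ∀ k x → Δ (suc k) (qShift (suc k) x) ≡ Δ k x * ω k x (q * x (suc k))
  Δ-qShift-top k x = cong₂ _*_ (Δ-cong k below) (begin
    ω k (qShift (suc k) x) (qShift (suc k) x (suc k))  ≡⟨ ω-cong k (qShift (suc k) x (suc k)) below ⟩
    ω k x (qShift (suc k) x (suc k))                   ≡⟨ cong (ω k x) (qShift-≡ (suc k) x) ⟩
    ω k x (q * x (suc k))                              ∎)
    where
    below : ∀ i → i ∈[1, k ] → qShift (suc k) x i ≡ x i
    below i (_ , i≤k) = qShift-≢ x (ℕₚ.<⇒≢ (s≤s i≤k))

  Δ-qShift : ∀ k {m} x → m ∈[1, k ] →
             Δ (suc k) (qShift m x) ≡ Δ k (qShift m x) * (ωExcept k m x (x (suc k)) * (x (suc k) - q * x m))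
  Δ-qShift k {m} x m∈@(_ , m≤k) = cong (Δ k (qShift m x) *_) (begin
    ω k (qShift m x) (qShift m x (suc k))
      ≡⟨ cong (ω k (qShift m x)) (qShift-≢ x (ℕₚ.>⇒≢ (s≤s m≤k))) ⟩
    ω k (qShift m x) u
      ≡⟨ ω-extract k (qShift m x) u m∈ ⟩
    ωExcept k m (qShift m x) u * (u - qShift m x m)
      ≡⟨ cong₂ (λ a b → a * (u - b))
               (Π-cong k (λ i _ → update-cong m 1ℚ (λ i i≢m → cong (λ a → u - a) (qShift-≢ x i≢m)) i))
               (qShift-≡ m x) ⟩
    ωExcept k m x u * (u - q * x m) ∎)
    where
    u = x (suc k)

  lagrangeTerm : ℕ → (ℕ → ℚ) → ℚ → ℕ → ℚ
  lagrangeTerm k x t m = x m * Δ k (qShift m x) * ωExcept k m x t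

  lagrangeSum : ℕ → (ℕ → ℚ) → ℚ → ℚ
  lagrangeSum k x t = Σ k (lagrangeTerm k x t)

  Δ-qShift-lagrange : ∀ k {m} x → m ∈[1, k ] →
    Δ (suc k) (qShift m x) ≡
    ω k x (x (suc k)) * Δ k (qShift m x) + (1ℚ - q) * lagrangeTerm k x (x (suc k)) m
  Δ-qShift-lagrange k {m} x m∈ = begin
    Δ (suc k) (qShift m x)
      ≡⟨ Δ-qShift k x m∈ ⟩
    D′ * (a * (u - q * x m))
      ≡⟨ split D′ a u (x m) q ⟩
    a * (u - x m) * D′ + (1ℚ - q) * (x m * D′ * a)
      ≡⟨ cong (λ e → e * D′ + (1ℚ - q) * (x m * D′ * a)) (ω-extract k x u m∈) ⟨
    ω k x u * D′ + (1ℚ - q) * (x m * D′ * a)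
      ∎
    where
    u  = x (suc k)
    D′ = Δ k (qShift m x)
    a  = ωExcept k m x u
    split : ∀ D′ a u xm q → D′ * (a * (u - q * xm)) ≡ a * (u - xm) * D′ + (1ℚ - q) * (xm * D′ * a)
    split = solve-∀ ℚ-ring

  lagrangeTerm-suc : ∀ k {m} x t → m ∈[1, k ] →
    lagrangeTerm (suc k) x t m ≡
    (q * t - x (suc k)) * ω k x (x (suc k)) * lagrangeTerm k x t m
      + (1ℚ - q) * x (suc k) * ω k x t * lagrangeTerm k x (x (suc k)) m
  lagrangeTerm-suc k {m} x t m∈@(_ , m≤k) = begin
    x m * Δ (suc k) (qShift m x) * ωExcept (suc k) m x t
      ≡⟨ cong₂ (λ d e → x m * d * e) (Δ-qShift k x m∈) (ωExcept-suc k x t m≤k) ⟩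
    x m * (D′ * (a * (u - q * x m))) * (b * (t - u))
      ≡⟨ split (x m) D′ a b u t q ⟩
    (q * t - u) * (a * (u - x m)) * (x m * D′ * b) + (1ℚ - q) * u * (b * (t - x m)) * (x m * D′ * a)
      ≡⟨ cong₂ (λ e f → (q * t - u) * e * (x m * D′ * b) + (1ℚ - q) * u * f * (x m * D′ * a))
               (ω-extract k x u m∈) (ω-extract k x t m∈) ⟨
    (q * t - u) * ω k x u * (x m * D′ * b) + (1ℚ - q) * u * ω k x t * (x m * D′ * a)
      ∎
    where
    u  = x (suc k)
    D′ = Δ k (qShift m x)
    a  = ωExcept k m x u
    b  = ωExcept k m x t
    split : ∀ xm D′ a b u t q →
      xm * (D′ * (a * (u - q * xm))) * (b * (t - u))
      ≡ (q * t - u) * (a * (u - xm)) * (xm * D′ * b) + (1ℚ - q) * u * (b * (t - xm)) * (xm * D′ * a)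
    split = solve-∀ ℚ-ring

  lagrangeTerm-top : ∀ k x t →
    lagrangeTerm (suc k) x t (suc k) ≡ x (suc k) * (Δ k x * ω k x (q * x (suc k))) * ω k x t
  lagrangeTerm-top k x t = cong₂ (λ d e → x (suc k) * d * e) (Δ-qShift-top k x) (ωExcept-top k x t)

  -- Σ-Δ-qShift does not survive induction on its own: its step needs lagrangeSum at t = x (k + 1).
  lagrangeSum-closed : ∀ k x t →
    (q - 1ℚ) * lagrangeSum k x t ≡ Δ k x * (ω k x (q * t) - q ^ℕ k * ω k x t)
  lagrangeSum-closed zero    x t = ℚₚ.*-zeroʳ (q - 1ℚ)
  lagrangeSum-closed (suc k) x t = begin
    (q - 1ℚ) * (Σ k (lagrangeTerm (suc k) x t) + lagrangeTerm (suc k) x t (suc k))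
      ≡⟨ cong₂ (λ s e → (q - 1ℚ) * (s + e))
               (Σ-linear k A B (λ m m∈ → lagrangeTerm-suc k x t m∈)) (lagrangeTerm-top k x t) ⟩
    (q - 1ℚ) * (A * lagrangeSum k x t + B * lagrangeSum k x u + u * (D * Fu) * Et)
      ≡⟨ distribute (q - 1ℚ) A B (lagrangeSum k x t) (lagrangeSum k x u) (u * (D * Fu) * Et) ⟩
    A * ((q - 1ℚ) * lagrangeSum k x t) + B * ((q - 1ℚ) * lagrangeSum k x u) + (q - 1ℚ) * (u * (D * Fu) * Et)
      ≡⟨ cong₂ (λ a b → A * a + B * b + (q - 1ℚ) * (u * (D * Fu) * Et))
               (lagrangeSum-closed k x t) (lagrangeSum-closed k x u) ⟩
    A * (D * (Ft - q ^ℕ k * Et)) + B * (D * (Fu - q ^ℕ k * Eu)) + (q - 1ℚ) * (u * (D * Fu) * Et)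
      ≡⟨ collect D Eu Et Fu Ft (q ^ℕ k) q u t ⟩
    D * Eu * (Ft * (q * t - u) - q * q ^ℕ k * (Et * (t - u)))
      ∎
    where
    u  = x (suc k)
    D  = Δ k x
    Eu = ω k x u
    Et = ω k x t
    Fu = ω k x (q * u)
    Ft = ω k x (q * t)
    A  = (q * t - u) * Eu
    B  = (1ℚ - q) * u * Et
    distribute : ∀ c a b i j e → c * (a * i + b * j + e) ≡ a * (c * i) + b * (c * j) + c * e
    distribute = solve-∀ ℚ-ring
    collect : ∀ D Eu Et Fu Ft qk q u t →
      (q * t - u) * Eu * (D * (Ft - qk * Et)) + (1ℚ - q) * u * Et * (D * (Fu - qk * Eu))
        + (q - 1ℚ) * (u * (D * Fu) * Et)
      ≡ D * Eu * (Ft * (q * t - u) - q * qk * (Et * (t - u)))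
    collect = solve-∀ ℚ-ring

  Σ-Δ-qShift : ∀ k x → Σ k (λ m → Δ k (qShift m x)) ≡ [ k ] q * Δ k x
  Σ-Δ-qShift zero    x = sym (ℚₚ.*-zeroˡ 1ℚ)
  Σ-Δ-qShift (suc k) x = begin
    Σ k (λ m → Δ (suc k) (qShift m x)) + Δ (suc k) (qShift (suc k) x)
      ≡⟨ cong₂ _+_ (Σ-linear k Eu (1ℚ - q) (λ m m∈ → Δ-qShift-lagrange k x m∈)) (Δ-qShift-top k x) ⟩
    Eu * Σ k (λ m → Δ k (qShift m x)) + (1ℚ - q) * lagrangeSum k x u + D * Fu
      ≡⟨ negate Eu (Σ k (λ m → Δ k (qShift m x))) (lagrangeSum k x u) (D * Fu) q ⟩
    Eu * Σ k (λ m → Δ k (qShift m x)) - (q - 1ℚ) * lagrangeSum k x u + D * Fu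
      ≡⟨ cong₂ (λ s i → Eu * s - i + D * Fu) (Σ-Δ-qShift k x) (lagrangeSum-closed k x u) ⟩
    Eu * ([ k ] q * D) - D * (Fu - q ^ℕ k * Eu) + D * Fu
      ≡⟨ collect Eu ([ k ] q) D Fu (q ^ℕ k) ⟩
    ([ k ] q + q ^ℕ k) * (D * Eu)
      ∎
    where
    u  = x (suc k)
    D  = Δ k x
    Eu = ω k x u
    Fu = ω k x (q * u)
    negate : ∀ e s i f q → e * s + (1ℚ - q) * i + f ≡ e * s - (q - 1ℚ) * i + f
    negate = solve-∀ ℚ-ring
    collect : ∀ e b D f qk → e * (b * D) - D * (f - qk * e) + D * f ≡ (b + qk) * (D * e)
    collect = solve-∀ ℚ-ring

  qShift-join-low : ∀ {m i} x y → i ≤ m → ∀ k → qShift i (join m x y) k ≡ join m (qShift i x) y k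
  qShift-join-low {m} {i} x y i≤m k =
    trans (cong (λ v → update (join m x y) i v k) (cong (q *_) (join-≤ x y i≤m)))
          (join-update-low x y (q * x i) i≤m k)

  qShift-join-high : ∀ {m j} x y → 1 ≤ j → ∀ k →
                     qShift (j ℕ.+ m) (join m x y) k ≡ join m x (qShift j y) k
  qShift-join-high {m} {j} x y 1≤j k =
    trans (cong (λ v → update (join m x y) (j ℕ.+ m) v k) (cong (q *_) (join-+ {m} x y 1≤j)))
          (join-update-high x y (q * y j) 1≤j k)

  qShift-scale : ∀ {i} c x k → qShift i (c · x) k ≡ (c · qShift i x) k
  qShift-scale {i} c x k = cases (k ℕ.≟ i)
    where
    swap : ∀ a b c → a * (b * c) ≡ b * (a * c)
    swap = solve-∀ ℚ-ring
    cases : Dec (k ≡ i) → qShift i (c · x) k ≡ (c · qShift i x) k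
    cases (yes refl) = trans (qShift-≡ k (c · x)) (trans (swap q c (x k)) (cong (c *_) (sym (qShift-≡ k x))))
    cases (no k≢i)   = trans (qShift-≢ (c · x) k≢i) (cong (c *_) (sym (qShift-≢ x k≢i)))

module _ (r₁ r₂ : ℕ) (Q : ℚ) where

  Δ₂ : (ℕ → ℚ) → (ℕ → ℚ) → ℚ
  Δ₂ x y = Δ r₁ x * Δ r₂ y * Π r₁ (λ i → Π r₂ (λ j → y j + Q * x i))

  Δ₂-congˡ : ∀ {x x′} y → (∀ i → x i ≡ x′ i) → Δ₂ x y ≡ Δ₂ x′ y
  Δ₂-congˡ y x≡x′ = cong₂ (λ d c → d * Δ r₂ y * c) (Δ-cong r₁ (λ i _ → x≡x′ i))
    (Π-cong r₁ (λ i _ → Π-cong r₂ (λ j _ → cong (λ u → y j + Q * u) (x≡x′ i))))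

  Δ₂-congʳ : ∀ x {y y′} → (∀ j → y j ≡ y′ j) → Δ₂ x y ≡ Δ₂ x y′
  Δ₂-congʳ x y≡y′ = cong₂ (λ d c → Δ r₁ x * d * c) (Δ-cong r₂ (λ j _ → y≡y′ j))
    (Π-cong r₁ (λ i _ → Π-cong r₂ (λ j _ → cong (λ u → u + Q * x i) (y≡y′ j))))

  Δ₂-join : ∀ x y → Δ (r₂ ℕ.+ r₁) (join r₁ ((- Q) · x) y) ≡ Π r₁ (λ j → (- Q) ^ℕ (j ∸ 1)) * Δ₂ x y
  Δ₂-join x y = begin
    Δ (r₂ ℕ.+ r₁) (join r₁ ((- Q) · x) y)
      ≡⟨ Δ-join r₂ r₁ ((- Q) · x) y ⟩
    Δ r₁ ((- Q) · x) * Π r₂ (λ j → ω r₁ ((- Q) · x) (y j)) * Δ r₂ y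
      ≡⟨ cong₂ (λ d c → d * c * Δ r₂ y) (Δ-scale r₁ (- Q) x) cross ⟩
    μ * Δ r₁ x * C * Δ r₂ y
      ≡⟨ rearrange μ (Δ r₁ x) C (Δ r₂ y) ⟩
    μ * Δ₂ x y ∎
    where
    μ = Π r₁ (λ j → (- Q) ^ℕ (j ∸ 1))
    C = Π r₁ (λ i → Π r₂ (λ j → y j + Q * x i))
    negate : ∀ t Q x → t - (- Q) * x ≡ t + Q * x
    negate = solve-∀ ℚ-ring
    rearrange : ∀ m a c b → m * a * c * b ≡ m * (a * b * c)
    rearrange = solve-∀ ℚ-ring
    cross : Π r₂ (λ j → ω r₁ ((- Q) · x) (y j)) ≡ C
    cross = trans (Π-cong r₂ (λ j _ → Π-cong r₁ (λ i _ → negate (y j) Q (x i))))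
                  (Π-swap r₂ r₁ (λ j i → y j + Q * x i))

  Δ₂-Q≡0 : Q ≡ 0ℚ → ∀ x y → Δ₂ x y ≡ Δ r₁ x * Δ r₂ y * Π r₂ y ^ℕ r₁
  Δ₂-Q≡0 Q≡0 x y = cong (Δ r₁ x * Δ r₂ y *_) (begin
    Π r₁ (λ i → Π r₂ (λ j → y j + Q * x i))  ≡⟨ Π-cong r₁ (λ i _ → Π-cong r₂ (λ j _ → vanish i j)) ⟩
    Π r₁ (λ _ → Π r₂ y)                      ≡⟨ Π-const r₁ (Π r₂ y) ⟩
    Π r₂ y ^ℕ r₁                             ∎)
    where
    vanish : ∀ i j → y j + Q * x i ≡ y j
    vanish i j = begin
      y j + Q * x i    ≡⟨ cong (λ Q → y j + Q * x i) Q≡0 ⟩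
      y j + 0ℚ * x i   ≡⟨ cong (y j +_) (ℚₚ.*-zeroˡ (x i)) ⟩
      y j + 0ℚ         ≡⟨ ℚₚ.+-identityʳ (y j) ⟩
      y j              ∎

  module _ (q : ℚ) where

    Σ-Δ₂-qShift-Q≢0 : Q ≢ 0ℚ → ∀ x y →
      Σ r₁ (λ i → Δ₂ (qShift q i x) y) + Σ r₂ (λ j → Δ₂ x (qShift q j y)) ≡ [ r₂ ℕ.+ r₁ ] q * Δ₂ x y
    Σ-Δ₂-qShift-Q≢0 Q≢0 x y = *-cancelˡ μ≢0 (begin
      μ * (Σ r₁ (λ i → Δ₂ (qShift q i x) y) + Σ r₂ (λ j → Δ₂ x (qShift q j y)))
        ≡⟨ ℚₚ.*-distribˡ-+ μ _ _ ⟩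
      μ * Σ r₁ (λ i → Δ₂ (qShift q i x) y) + μ * Σ r₂ (λ j → Δ₂ x (qShift q j y))
        ≡⟨ cong₂ _+_ (*-distribˡ-Σ r₁ μ _) (*-distribˡ-Σ r₂ μ _) ⟩
      Σ r₁ (λ i → μ * Δ₂ (qShift q i x) y) + Σ r₂ (λ j → μ * Δ₂ x (qShift q j y))
        ≡⟨ cong₂ _+_ (Σ-cong r₁ low) (Σ-cong r₂ high) ⟨
      Σ r₁ (λ i → Δ r (qShift q i z)) + Σ r₂ (λ j → Δ r (qShift q (j ℕ.+ r₁) z))
        ≡⟨ Σ-split r₂ r₁ (λ m → Δ r (qShift q m z)) ⟨
      Σ r (λ m → Δ r (qShift q m z))
        ≡⟨ Σ-Δ-qShift q r z ⟩
      [ r ] q * Δ r z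
        ≡⟨ cong ([ r ] q *_) (Δ₂-join x y) ⟩
      [ r ] q * (μ * Δ₂ x y)
        ≡⟨ swap ([ r ] q) μ (Δ₂ x y) ⟩
      μ * ([ r ] q * Δ₂ x y) ∎)
      where
      r = r₂ ℕ.+ r₁
      z = join r₁ ((- Q) · x) y
      μ = Π r₁ (λ j → (- Q) ^ℕ (j ∸ 1))
      μ≢0 : μ ≢ 0ℚ
      μ≢0 = Π-≢0 r₁ _ (λ j _ → ^-≢0 (j ∸ 1) (λ -Q≡0 → Q≢0 (ℚₚ.neg-injective -Q≡0)))
      swap : ∀ a b c → a * (b * c) ≡ b * (a * c)
      swap = solve-∀ ℚ-ring
      low : ∀ i → i ∈[1, r₁ ] → Δ r (qShift q i z) ≡ μ * Δ₂ (qShift q i x) y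
      low i (_ , i≤r₁) = trans (Δ-cong r {qShift q i z} {join r₁ ((- Q) · qShift q i x) y} commute)
                               (Δ₂-join (qShift q i x) y)
        where
        commute : ∀ k → _ → qShift q i z k ≡ join r₁ ((- Q) · qShift q i x) y k
        commute k _ = trans (qShift-join-low q ((- Q) · x) y i≤r₁ k)
                            (join-congˡ r₁ {qShift q i ((- Q) · x)} y k (qShift-scale q {i} (- Q) x k))
      high : ∀ j → j ∈[1, r₂ ] → Δ r (qShift q (j ℕ.+ r₁) z) ≡ μ * Δ₂ x (qShift q j y)
      high j (1≤j , _) =
        trans (Δ-cong r (λ k _ → qShift-join-high q ((- Q) · x) y 1≤j k)) (Δ₂-join x (qShift q j y))

    Σ-Δ₂-qShift-Q≡0 : Q ≡ 0ℚ → ∀ x y →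
      Σ r₁ (λ i → Δ₂ (qShift q i x) y) + Σ r₂ (λ j → Δ₂ x (qShift q j y)) ≡ [ r₂ ℕ.+ r₁ ] q * Δ₂ x y
    Σ-Δ₂-qShift-Q≡0 Q≡0 x y = begin
      Σ r₁ (λ i → Δ₂ (qShift q i x) y) + Σ r₂ (λ j → Δ₂ x (qShift q j y))
        ≡⟨ cong₂ _+_ (Σ-cong r₁ low) (Σ-cong r₂ high) ⟩
      Σ r₁ (λ i → a * Δ r₁ (qShift q i x)) + Σ r₂ (λ j → b * Δ r₂ (qShift q j y))
        ≡⟨ cong₂ _+_ (*-distribˡ-Σ r₁ a _) (*-distribˡ-Σ r₂ b _) ⟨
      a * Σ r₁ (λ i → Δ r₁ (qShift q i x)) + b * Σ r₂ (λ j → Δ r₂ (qShift q j y))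
        ≡⟨ cong₂ (λ s t → a * s + b * t) (Σ-Δ-qShift q r₁ x) (Σ-Δ-qShift q r₂ y) ⟩
      a * ([ r₁ ] q * Δ r₁ x) + b * ([ r₂ ] q * Δ r₂ y)
        ≡⟨ collect (Δ r₁ x) (Δ r₂ y) Y (q ^ℕ r₁) ([ r₁ ] q) ([ r₂ ] q) ⟩
      ([ r₁ ] q + q ^ℕ r₁ * [ r₂ ] q) * (Δ r₁ x * Δ r₂ y * Y)
        ≡⟨ cong₂ _*_ (qInt-+ q r₂ r₁) (Δ₂-Q≡0 Q≡0 x y) ⟨
      [ r₂ ℕ.+ r₁ ] q * Δ₂ x y ∎
      where
      Y = Π r₂ y ^ℕ r₁
      a = Δ r₂ y * Y
      b = Δ r₁ x * (q ^ℕ r₁ * Y)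
      collect : ∀ X V Y c s t → V * Y * (s * X) + X * (c * Y) * (t * V) ≡ (s + c * t) * (X * V * Y)
      collect = solve-∀ ℚ-ring
      rotate : ∀ a b c → a * b * c ≡ b * c * a
      rotate = solve-∀ ℚ-ring
      low : ∀ i → i ∈[1, r₁ ] → Δ₂ (qShift q i x) y ≡ a * Δ r₁ (qShift q i x)
      low i _ = trans (Δ₂-Q≡0 Q≡0 (qShift q i x) y) (rotate (Δ r₁ (qShift q i x)) (Δ r₂ y) Y)
      high : ∀ j → j ∈[1, r₂ ] → Δ₂ x (qShift q j y) ≡ b * Δ r₂ (qShift q j y)
      high j j∈ = begin
        Δ₂ x (qShift q j y)
          ≡⟨ Δ₂-Q≡0 Q≡0 x (qShift q j y) ⟩
        Δ r₁ x * Δ r₂ (qShift q j y) * Π r₂ (qShift q j y) ^ℕ r₁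
          ≡⟨ cong (λ p → Δ r₁ x * Δ r₂ (qShift q j y) * p ^ℕ r₁) (Π-qShift q r₂ y j∈) ⟩
        Δ r₁ x * Δ r₂ (qShift q j y) * (q * Π r₂ y) ^ℕ r₁
          ≡⟨ cong (Δ r₁ x * Δ r₂ (qShift q j y) *_) (^-distribʳ-* q (Π r₂ y) r₁) ⟩
        Δ r₁ x * Δ r₂ (qShift q j y) * (q ^ℕ r₁ * Y)
          ≡⟨ swapMiddle (Δ r₁ x) (Δ r₂ (qShift q j y)) (q ^ℕ r₁ * Y) ⟩
        b * Δ r₂ (qShift q j y) ∎
        where
        swapMiddle : ∀ a b c → a * b * c ≡ a * c * b
        swapMiddle = solve-∀ ℚ-ring

    Σ-Δ₂-qShift : ∀ x y →
      Σ r₁ (λ i → Δ₂ (qShift q i x) y) + Σ r₂ (λ j → Δ₂ x (qShift q j y)) ≡ [ r₁ ℕ.+ r₂ ] q * Δ₂ x y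
    Σ-Δ₂-qShift x y = trans (cases (Q ≟ 0ℚ)) (cong (λ r → [ r ] q * Δ₂ x y) (ℕₚ.+-comm r₂ r₁))
      where
      cases : Dec (Q ≡ 0ℚ) → _ ≡ [ r₂ ℕ.+ r₁ ] q * Δ₂ x y
      cases (yes Q≡0) = Σ-Δ₂-qShift-Q≡0 Q≡0 x y
      cases (no  Q≢0) = Σ-Δ₂-qShift-Q≢0 Q≢0 x y

sumℚ-++ : ∀ xs ys → sumℚ (xs ++ ys) ≡ sumℚ xs + sumℚ ys
sumℚ-++ []       ys = sym (ℚₚ.+-identityˡ (sumℚ ys))
sumℚ-++ (x ∷ xs) ys = trans (cong (x +_) (sumℚ-++ xs ys)) (sym (ℚₚ.+-assoc x (sumℚ xs) (sumℚ ys)))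

sumℚ-filterᵇ : ∀ p (h : ℕ → ℚ) l →
               sumℚ (map h (filterᵇ p l)) ≡ sumℚ (map (λ i → if p i then h i else 0ℚ) l)
sumℚ-filterᵇ p h []      = refl
sumℚ-filterᵇ p h (a ∷ l) with p a
... | true  = cong (h a +_) (sumℚ-filterᵇ p h l)
... | false = trans (sumℚ-filterᵇ p h l) (sym (ℚₚ.+-identityˡ _))

part-beyond : ∀ α {j} → length α < j → part α j ≡ 0
part-beyond []      _                 = refl
part-beyond (a ∷ α) {suc zero}    (s≤s ())
part-beyond (a ∷ α) {suc (suc j)} (s≤s ℓ<1+j) = part-beyond α ℓ<1+j

part-antitone : ∀ {α} → Linked ℕ._≥_ α → ∀ i → part α (suc (suc i)) ≤ part α (suc i)
part-antitone []                  i       = z≤n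
part-antitone [-]                 i       = z≤n
part-antitone (a≥b ∷ _)           zero    = a≥b
part-antitone (_ ∷ linked)        (suc i) = part-antitone linked i

part-incAt : ∀ α {i} → 1 ≤ i → i ≤ suc (length α) →
             ∀ k → part (incAt α i) k ≡ update (part α) i (suc (part α i)) k
part-incAt []      {suc zero}    _ _ zero          = refl
part-incAt []      {suc zero}    _ _ (suc zero)    = refl
part-incAt []      {suc zero}    _ _ (suc (suc k)) = refl
part-incAt []      {suc (suc i)} _ (s≤s ())
part-incAt (a ∷ α) {suc zero}    _ _ zero          = refl
part-incAt (a ∷ α) {suc zero}    _ _ (suc zero)    = refl
part-incAt (a ∷ α) {suc zero}    _ _ (suc (suc k)) = refl
part-incAt (a ∷ α) {suc (suc i)} _ _ zero          = refl
part-incAt (a ∷ α) {suc (suc i)} _ _ (suc zero)    = refl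
part-incAt (a ∷ α) {suc (suc i)} _ (s≤s i≤ℓ) (suc (suc k)) = part-incAt α (s≤s z≤n) i≤ℓ (suc k)

size-incAt : ∀ α {i} → 1 ≤ i → i ≤ suc (length α) → size (incAt α i) ≡ suc (size α)
size-incAt []      {suc zero}    _ _         = refl
size-incAt []      {suc (suc i)} _ (s≤s ())
size-incAt (a ∷ α) {suc zero}    _ _         = refl
size-incAt (a ∷ α) {suc (suc i)} _ (s≤s i≤ℓ) =
  trans (cong (a ℕ.+_) (size-incAt α (s≤s z≤n) i≤ℓ)) (ℕₚ.+-suc a (size α))

length-incAt-≤ : ∀ α {i n} → 1 ≤ i → length α ≤ n → i ≤ n → length (incAt α i) ≤ n
length-incAt-≤ []      {suc i}       {suc n} _ _ _ = s≤s z≤n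
length-incAt-≤ (a ∷ α) {suc zero}            _ ℓ≤n _ = ℓ≤n
length-incAt-≤ (a ∷ α) {suc (suc i)} {suc n} _ (s≤s ℓ≤n) (s≤s i≤n) =
  s≤s (length-incAt-≤ α (s≤s z≤n) ℓ≤n i≤n)

length-incAt-≥ : ∀ α i → length α ≤ length (incAt α i)
length-incAt-≥ []      i             = z≤n
length-incAt-≥ (a ∷ α) zero          = ℕₚ.≤-refl
length-incAt-≥ (a ∷ α) (suc zero)    = ℕₚ.≤-refl
length-incAt-≥ (a ∷ α) (suc (suc i)) = s≤s (length-incAt-≥ α (suc i))

≤-length-incAt : ∀ α {i} → i ≤ suc (length α) → i ≤ length (incAt α i)
≤-length-incAt []      {zero}        _ = z≤n
≤-length-incAt []      {suc zero}    _ = ℕₚ.≤-refl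
≤-length-incAt []      {suc (suc i)} (s≤s ())
≤-length-incAt (a ∷ α) {zero}        _ = z≤n
≤-length-incAt (a ∷ α) {suc zero}    _ = s≤s z≤n
≤-length-incAt (a ∷ α) {suc (suc i)} (s≤s i≤ℓ) = s≤s (≤-length-incAt α i≤ℓ)

canAdd-bounded : ∀ α {i} → canAdd α i ≡ true → i ≤ suc (length α)
canAdd-bounded α {suc zero}    _  = s≤s z≤n
canAdd-bounded α {suc (suc i)} eq with ℕₚ.≤-<-connex (suc i) (length α)
... | inj₁ 1+i≤ℓ = s≤s 1+i≤ℓ
... | inj₂ ℓ<1+i = ⊥-elim (ℕₚ.n≮0 (subst (part α (suc (suc i)) <_) (part-beyond α ℓ<1+i)
                     (ℕₚ.<ᵇ⇒< _ _ (subst T (sym eq) _))))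

canAdd-false : ∀ {α i} → Linked ℕ._≥_ α → 1 ≤ i → canAdd α i ≡ false →
               2 ≤ i × part α (i ∸ 1) ≡ part α i
canAdd-false {α} {suc (suc i)} linked _ eq =
  s≤s (s≤s z≤n) ,
  ℕₚ.≤-antisym (ℕₚ.≮⇒≥ (λ lt → subst T eq (ℕₚ.<⇒<ᵇ lt))) (part-antitone linked i)

sumℚ-addBox : ∀ (F : List ℕ → ℚ) α →
  sumℚ (map F (addBox α)) ≡ Σ (suc (length α)) (λ i → if canAdd α i then F (incAt α i) else 0ℚ)
sumℚ-addBox F α = begin
  sumℚ (map F (map (incAt α) rows))
    ≡⟨ cong sumℚ (Listₚ.map-∘ {g = F} {f = incAt α} rows) ⟨
  sumℚ (map (λ i → F (incAt α i)) rows)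
    ≡⟨ sumℚ-filterᵇ (canAdd α) (λ i → F (incAt α i)) (map suc (upTo (suc (length α)))) ⟩
  sumℚ (map g (map suc (upTo (suc (length α)))))
    ≡⟨ cong sumℚ (Listₚ.map-∘ {g = g} {f = suc} (upTo (suc (length α)))) ⟨
  sumℚ (map (λ i → g (suc i)) (upTo (suc (length α))))
    ≡⟨ cong sumℚ (Listₚ.map-upTo (λ i → g (suc i)) (suc (length α))) ⟩
  sumℚ (applyUpTo (λ i → g (suc i)) (suc (length α)))
    ≡⟨ Σ-applyUpTo (suc (length α)) g ⟩
  Σ (suc (length α)) g ∎
  where
  rows = filterᵇ (canAdd α) (map suc (upTo (suc (length α))))
  g : ℕ → ℚ
  g i = if canAdd α i then F (incAt α i) else 0ℚ

sumℚ-addBox-vanish : ∀ (F : List ℕ → ℚ) α → (∀ i → F (incAt α i) ≡ 0ℚ) → sumℚ (map F (addBox α)) ≡ 0ℚ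
sumℚ-addBox-vanish F α F≡0 =
  trans (sumℚ-addBox F α) (trans (Σ-cong (suc (length α)) vanish) (Σ-0 (suc (length α))))
  where
  vanish : ∀ i → _ → (if canAdd α i then F (incAt α i) else 0ℚ) ≡ 0ℚ
  vanish i _ with canAdd α i
  ... | true  = F≡0 i
  ... | false = refl

Σ-addBox : ∀ {r} (F : List ℕ → ℚ) (G : ℕ → ℚ) α → Linked ℕ._≥_ α →
  (∀ γ → r < length γ → F γ ≡ 0ℚ) →
  (∀ i → i ∈[1, r ] → canAdd α i ≡ true → F (incAt α i) ≡ G i) →
  (∀ i → 2 ≤ i → i ≤ r → part α (i ∸ 1) ≡ part α i → G i ≡ 0ℚ) →
  sumℚ (map F (addBox α)) ≡ Σ r G
Σ-addBox {r} F G α linked F-long F≡G G-collision = begin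
  sumℚ (map F (addBox α))     ≡⟨ sumℚ-addBox F α ⟩
  Σ (suc (length α)) g        ≡⟨ Σ-supported g beyond-rows beyond-r ⟩
  Σ r g                       ≡⟨ Σ-cong r g≡G ⟩
  Σ r G                       ∎
  where
  g : ℕ → ℚ
  g i = if canAdd α i then F (incAt α i) else 0ℚ
  beyond-rows : ∀ i → suc (length α) < i → g i ≡ 0ℚ
  beyond-rows i ℓ+1<i with canAdd α i in eq
  ... | true  = ⊥-elim (ℕₚ.<⇒≱ ℓ+1<i (canAdd-bounded α eq))
  ... | false = refl
  beyond-r : ∀ i → r < i → g i ≡ 0ℚ
  beyond-r i r<i with canAdd α i in eq
  ... | true  = F-long (incAt α i) (ℕₚ.<-≤-trans r<i (≤-length-incAt α (canAdd-bounded α eq)))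
  ... | false = refl
  g≡G : ∀ i → i ∈[1, r ] → g i ≡ G i
  g≡G i i∈@(1≤i , i≤r) with canAdd α i in eq
  ... | true  = F≡G i i∈ eq
  ... | false = let (2≤i , collision) = canAdd-false linked 1≤i eq in sym (G-collision i 2≤i i≤r collision)

sumℚ-addBox₂ : ∀ (F : List ℕ × List ℕ → ℚ) α β → sumℚ (map F (addBox₂ (α , β)))
               ≡ sumℚ (map (λ γ → F (γ , β)) (addBox α)) + sumℚ (map (λ η → F (α , η)) (addBox β))
sumℚ-addBox₂ F α β = begin
  sumℚ (map F (map (λ γ → (γ , β)) (addBox α) ++ map (λ η → (α , η)) (addBox β)))
    ≡⟨ cong sumℚ (Listₚ.map-++ F (map (λ γ → (γ , β)) (addBox α)) (map (λ η → (α , η)) (addBox β))) ⟩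
  sumℚ (map F (map (λ γ → (γ , β)) (addBox α)) ++ map F (map (λ η → (α , η)) (addBox β)))
    ≡⟨ sumℚ-++ (map F (map (λ γ → (γ , β)) (addBox α))) (map F (map (λ η → (α , η)) (addBox β))) ⟩
  sumℚ (map F (map (λ γ → (γ , β)) (addBox α))) + sumℚ (map F (map (λ η → (α , η)) (addBox β)))
    ≡⟨ cong₂ (λ u v → sumℚ u + sumℚ v) (Listₚ.map-∘ {g = F} (addBox α)) (Listₚ.map-∘ {g = F} (addBox β)) ⟨
  sumℚ (map (λ γ → F (γ , β)) (addBox α)) + sumℚ (map (λ η → F (α , η)) (addBox β))
    ∎

-- W in product form

^-sum : ∀ x (g : ℕ → ℕ) l → x ^ℕ sum (map g l) ≡ foldr _*_ 1ℚ (map (λ i → x ^ℕ g i) l)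
^-sum x g []      = refl
^-sum x g (a ∷ l) = trans (^-distribˡ-+-* x (g a) (sum (map g l))) (cong (x ^ℕ g a *_) (^-sum x g l))

^-size : ∀ x α k → length α ≤ k → x ^ℕ size α ≡ Π k (λ j → x ^ℕ part α j)
^-size x []      k       _         = sym (Π-1 k)
^-size x (a ∷ α) (suc k) (s≤s ℓ≤k) = begin
  x ^ℕ (a ℕ.+ size α)                         ≡⟨ ^-distribˡ-+-* x a (size α) ⟩
  x ^ℕ a * x ^ℕ size α                        ≡⟨ cong (x ^ℕ a *_) (^-size x α k ℓ≤k) ⟩
  x ^ℕ a * Π k (λ j → x ^ℕ part α j)          ≡⟨ cong (x ^ℕ a *_) (Π-cong k (λ { (suc j) _ → refl })) ⟩
  x ^ℕ a * Π k (λ j → x ^ℕ part (a ∷ α) (suc j))  ≡⟨ Π-cons k (λ j → x ^ℕ part (a ∷ α) j) ⟨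
  Π (suc k) (λ j → x ^ℕ part (a ∷ α) j)       ∎

^-nfun : ∀ x α k → length α ≤ k → x ^ℕ nfun α ≡ Π k (λ j → (x ^ℕ part α j) ^ℕ (j ∸ 1))
^-nfun x α k ℓ≤k = begin
  x ^ℕ nfun α
    ≡⟨ ^-sum x (λ i → i ℕ.* part α (suc i)) (upTo (length α)) ⟩
  foldr _*_ 1ℚ (map (λ i → F (suc i)) (upTo (length α)))
    ≡⟨ prodTo-Π (length α) F ⟩
  Π (length α) F
    ≡⟨ Π-extend F ℓ≤k beyond ⟨
  Π k F
    ≡⟨ Π-cong k (λ j _ → trans (cong (x ^ℕ_) (ℕₚ.*-comm (j ∸ 1) (part α j)))
                               (sym (^-*-assoc x (part α j) (j ∸ 1)))) ⟩
  Π k (λ j → (x ^ℕ part α j) ^ℕ (j ∸ 1))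
    ∎
  where
  F : ℕ → ℚ
  F j = x ^ℕ ((j ∸ 1) ℕ.* part α j)
  beyond : ∀ j → length α < j → F j ≡ 1ℚ
  beyond j ℓ<j = cong (λ a → x ^ℕ a) (trans (cong ((j ∸ 1) ℕ.*_) (part-beyond α ℓ<j)) (ℕₚ.*-zeroʳ (j ∸ 1)))

ex-⊖ : ∀ a b c d → ex a b c d ≡ (a ℕ.+ c) ⊖ (b ℕ.+ d)
ex-⊖ a b c d = begin
  (ℤ.+ a ℤ.- ℤ.+ b) ℤ.+ (ℤ.+ c ℤ.- ℤ.+ d)     ≡⟨ regroup (ℤ.+ a) (ℤ.+ b) (ℤ.+ c) (ℤ.+ d) ⟩
  (ℤ.+ a ℤ.+ ℤ.+ c) ℤ.- (ℤ.+ b ℤ.+ ℤ.+ d)     ≡⟨ cong₂ ℤ._-_ (ℤₚ.pos-+ a c) (ℤₚ.pos-+ b d) ⟨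
  ℤ.+ (a ℕ.+ c) ℤ.- ℤ.+ (b ℕ.+ d)         ≡⟨ ℤₚ.m-n≡m⊖n (a ℕ.+ c) (b ℕ.+ d) ⟩
  (a ℕ.+ c) ⊖ (b ℕ.+ d)               ∎
  where
  regroup : ∀ a b c d → (a ℤ.- b) ℤ.+ (c ℤ.- d) ≡ (a ℤ.+ c) ℤ.- (b ℤ.+ d)
  regroup = ℤ-Solver.solve-∀

module _ (q : ℚ) where

  coord : ℕ → ℕ → ℚ
  coord a i = q ^ℕ a * inv (q ^ℕ i)

  coords : List ℕ → ℕ → ℚ
  coords α i = coord (part α i) i

  coords-incAt : ∀ α {i} → 1 ≤ i → i ≤ suc (length α) → ∀ k → coords (incAt α i) k ≡ qShift q i (coords α) k
  coords-incAt α {i} 1≤i i≤ℓ+1 k = cases (k ℕ.≟ i)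
    where
    cases : Dec (k ≡ i) → coords (incAt α i) k ≡ qShift q i (coords α) k
    cases (yes refl) = begin
      coord (part (incAt α k) k) k       ≡⟨ cong (λ a → coord a k) (part-incAt α 1≤i i≤ℓ+1 k) ⟩
      coord (update (part α) k (suc (part α k)) k) k
                                         ≡⟨ cong (λ a → coord a k) (update-≡ (part α) k (suc (part α k))) ⟩
      q * q ^ℕ part α k * inv (q ^ℕ k)   ≡⟨ ℚₚ.*-assoc q (q ^ℕ part α k) (inv (q ^ℕ k)) ⟩
      q * coords α k                     ≡⟨ qShift-≡ q k (coords α) ⟨
      qShift q k (coords α) k            ∎
    cases (no k≢i) = begin
      coord (part (incAt α i) k) k       ≡⟨ cong (λ a → coord a k) (part-incAt α 1≤i i≤ℓ+1 k) ⟩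
      coord (update (part α) i (suc (part α i)) k) k
                                         ≡⟨ cong (λ a → coord a k) (update-≢ (part α) (suc (part α i)) k≢i) ⟩
      coords α k                         ≡⟨ qShift-≢ q (coords α) k≢i ⟨
      qShift q i (coords α) k            ∎

module _ {q : ℚ} (q≢0 : q ≢ 0ℚ) where

  q^-≢0 : ∀ n → q ^ℕ n ≢ 0ℚ
  q^-≢0 n = ^-≢0 n q≢0

  coord-≢0 : ∀ a i → coord q a i ≢ 0ℚ
  coord-≢0 a i = *-≢0 (q^-≢0 a) (inv-≢0 (q^-≢0 i))

  ^ℤ-⊖ : ∀ m n → q ^ℤ (m ⊖ n) ≡ q ^ℕ m * inv (q ^ℕ n)
  ^ℤ-⊖ zero    zero    = refl
  ^ℤ-⊖ zero    (suc n) = sym (ℚₚ.*-identityˡ (inv (q ^ℕ suc n)))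
  ^ℤ-⊖ (suc m) zero    = sym (ℚₚ.*-identityʳ (q ^ℕ suc m))
  ^ℤ-⊖ (suc m) (suc n) = begin
    q ^ℤ (suc m ⊖ suc n)                       ≡⟨ cong (q ^ℤ_) (ℤₚ.[1+m]⊖[1+n]≡m⊖n m n) ⟩
    q ^ℤ (m ⊖ n)                               ≡⟨ ^ℤ-⊖ m n ⟩
    q ^ℕ m * inv (q ^ℕ n)                      ≡⟨ cancel-q ⟨
    q * q ^ℕ m * (inv q * inv (q ^ℕ n))        ≡⟨ cong (q * q ^ℕ m *_) (inv-distrib-* q (q ^ℕ n)) ⟨
    q * q ^ℕ m * inv (q * q ^ℕ n)              ∎
    where
    regroup : ∀ q a b c → q * a * (b * c) ≡ q * b * (a * c)
    regroup = solve-∀ ℚ-ring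
    cancel-q : q * q ^ℕ m * (inv q * inv (q ^ℕ n)) ≡ q ^ℕ m * inv (q ^ℕ n)
    cancel-q = trans (regroup q (q ^ℕ m) (inv q) (inv (q ^ℕ n)))
                     (trans (cong (_* (q ^ℕ m * inv (q ^ℕ n))) (inv-inverseʳ q≢0))
                            (ℚₚ.*-identityˡ (q ^ℕ m * inv (q ^ℕ n))))

  ^ℤ-ex : ∀ a b i j → q ^ℤ ex a b j i ≡ coord q a i * inv (coord q b j)
  ^ℤ-ex a b i j = begin
    q ^ℤ ex a b j i
      ≡⟨ cong (q ^ℤ_) (ex-⊖ a b j i) ⟩
    q ^ℤ ((a ℕ.+ j) ⊖ (b ℕ.+ i))
      ≡⟨ ^ℤ-⊖ (a ℕ.+ j) (b ℕ.+ i) ⟩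
    q ^ℕ (a ℕ.+ j) * inv (q ^ℕ (b ℕ.+ i))
      ≡⟨ cong₂ (λ u v → u * inv v) (^-distribˡ-+-* q a j) (^-distribˡ-+-* q b i) ⟩
    q ^ℕ a * q ^ℕ j * inv (q ^ℕ b * q ^ℕ i)
      ≡⟨ cong (q ^ℕ a * q ^ℕ j *_) (inv-distrib-* (q ^ℕ b) (q ^ℕ i)) ⟩
    q ^ℕ a * q ^ℕ j * (inv (q ^ℕ b) * inv (q ^ℕ i))
      ≡⟨ regroup (q ^ℕ a) (q ^ℕ j) (inv (q ^ℕ b)) (inv (q ^ℕ i)) ⟩
    q ^ℕ a * inv (q ^ℕ i) * (inv (q ^ℕ b) * q ^ℕ j)
      ≡⟨ cong (λ c → coord q a i * (inv (q ^ℕ b) * c)) (inv-involutive (q ^ℕ j)) ⟨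
    coord q a i * (inv (q ^ℕ b) * inv (inv (q ^ℕ j)))
      ≡⟨ cong (coord q a i *_) (inv-distrib-* (q ^ℕ b) (inv (q ^ℕ j))) ⟨
    coord q a i * inv (coord q b j)
      ∎
    where
    regroup : ∀ a b c d → a * b * (c * d) ≡ a * d * (c * b)
    regroup = solve-∀ ℚ-ring

  1-^ℤ-ex : ∀ a b i j → 1ℚ - q ^ℤ ex a b j i ≡ (coord q b j - coord q a i) * inv (coord q b j)
  1-^ℤ-ex a b i j = begin
    1ℚ - q ^ℤ ex a b j i          ≡⟨ cong₂ (λ o r → o - r) (sym (inv-inverseʳ (coord-≢0 b j))) (^ℤ-ex a b i j) ⟩
    v * inv v - u * inv v         ≡⟨ factor v u (inv v) ⟩
    (v - u) * inv v               ∎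
    where
    u = coord q a i
    v = coord q b j
    factor : ∀ v u w → v * w - u * w ≡ (v - u) * w
    factor = solve-∀ ℚ-ring

  1+Q^ℤ-ex : ∀ Q a b i j → 1ℚ + Q * q ^ℤ ex a b j i ≡ (coord q b j + Q * coord q a i) * inv (coord q b j)
  1+Q^ℤ-ex Q a b i j = begin
    1ℚ + Q * q ^ℤ ex a b j i      ≡⟨ cong₂ (λ o r → o + Q * r) (sym (inv-inverseʳ (coord-≢0 b j))) (^ℤ-ex a b i j) ⟩
    v * inv v + Q * (u * inv v)   ≡⟨ factor v u (inv v) Q ⟩
    (v + Q * u) * inv v           ∎
    where
    u = coord q a i
    v = coord q b j
    factor : ∀ v u w Q → v * w + Q * (u * w) ≡ (v + Q * u) * w
    factor = solve-∀ ℚ-ring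

  ^-inv-coord : ∀ a j → q ^ℕ a * inv (coord q a j) ≡ q ^ℕ j
  ^-inv-coord a j = begin
    q ^ℕ a * inv (q ^ℕ a * inv (q ^ℕ j))
      ≡⟨ cong (q ^ℕ a *_) (inv-distrib-* (q ^ℕ a) (inv (q ^ℕ j))) ⟩
    q ^ℕ a * (inv (q ^ℕ a) * inv (inv (q ^ℕ j)))
      ≡⟨ cong (λ c → q ^ℕ a * (inv (q ^ℕ a) * c)) (inv-involutive (q ^ℕ j)) ⟩
    q ^ℕ a * (inv (q ^ℕ a) * q ^ℕ j)
      ≡⟨ ℚₚ.*-assoc (q ^ℕ a) (inv (q ^ℕ a)) (q ^ℕ j) ⟨
    q ^ℕ a * inv (q ^ℕ a) * q ^ℕ j
      ≡⟨ cong (_* q ^ℕ j) (inv-inverseʳ (q^-≢0 a)) ⟩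
    1ℚ * q ^ℕ j
      ≡⟨ ℚₚ.*-identityˡ (q ^ℕ j) ⟩
    q ^ℕ j
      ∎

  q*coord-suc : ∀ a n → q * coord q a (suc n) ≡ coord q a n
  q*coord-suc a n = begin
    q * (q ^ℕ a * inv (q * q ^ℕ n))              ≡⟨ cong (λ c → q * (q ^ℕ a * c)) (inv-distrib-* q (q ^ℕ n)) ⟩
    q * (q ^ℕ a * (inv q * inv (q ^ℕ n)))        ≡⟨ regroup q (q ^ℕ a) (inv q) (inv (q ^ℕ n)) ⟩
    q * inv q * coord q a n                      ≡⟨ cong (_* coord q a n) (inv-inverseʳ q≢0) ⟩
    1ℚ * coord q a n                             ≡⟨ ℚₚ.*-identityˡ (coord q a n) ⟩
    coord q a n                                  ∎
    where
    regroup : ∀ a b c d → a * (b * (c * d)) ≡ a * c * (b * d)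
    regroup = solve-∀ ℚ-ring

  Δ-qShift-repeated : ∀ k α {i} → 2 ≤ i → i ≤ k → part α (i ∸ 1) ≡ part α i →
                      Δ k (qShift q i (coords q α)) ≡ 0ℚ
  Δ-qShift-repeated k α {suc (suc i)} (s≤s (s≤s z≤n)) i+2≤k repeated =
    Δ-collision k (qShift q (2 ℕ.+ i) (coords q α)) (s≤s z≤n) ℕₚ.≤-refl i+2≤k (begin
      qShift q (2 ℕ.+ i) (coords q α) (suc i)       ≡⟨ qShift-≢ q (coords q α) (ℕₚ.<⇒≢ (ℕₚ.n<1+n (suc i))) ⟩
      coord q (part α (suc i)) (suc i)              ≡⟨ cong (λ a → coord q a (suc i)) repeated ⟩
      coord q (part α (2 ℕ.+ i)) (suc i)            ≡⟨ q*coord-suc (part α (2 ℕ.+ i)) (suc i) ⟨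
      q * coords q α (2 ℕ.+ i)                      ≡⟨ qShift-≡ q (2 ℕ.+ i) (coords q α) ⟨
      qShift q (2 ℕ.+ i) (coords q α) (2 ℕ.+ i)     ∎)

module _ (q : ℚ) where

  schurPS-zero : ∀ α k → k < length α → schurPS q α k ≡ 0ℚ
  schurPS-zero α k k<ℓ = if-T (k ℕ.<ᵇ length α) (ℕₚ.<⇒<ᵇ k<ℓ)

  W-zeroˡ : ∀ r₁ r₂ Q α β → r₁ < length α → W r₁ r₂ q Q (α , β) ≡ 0ℚ
  W-zeroˡ r₁ r₂ Q α β r₁<ℓ = begin
    q ^ℕ (r₁ ℕ.* size β) * schurPS q α r₁ * schurPS q β r₂ * c * C
      ≡⟨ cong (λ s → q ^ℕ (r₁ ℕ.* size β) * s * schurPS q β r₂ * c * C) (schurPS-zero α r₁ r₁<ℓ) ⟩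
    q ^ℕ (r₁ ℕ.* size β) * 0ℚ * schurPS q β r₂ * c * C
      ≡⟨ absorb (q ^ℕ (r₁ ℕ.* size β)) (schurPS q β r₂) c C ⟩
    0ℚ ∎
    where
    c = inv (((1ℚ - q ^ℕ (r₁ ℕ.+ r₂)) * inv (1ℚ - q)) ^ℕ (size α ℕ.+ size β))
    C = prodTo r₁ (λ i → prodTo r₂ (λ j → (1ℚ + Q * q ^ℤ ex (part α i) (part β j) j i)
                                          * inv (1ℚ + Q * q ^ℤ ex 0 0 j i)))
    absorb : ∀ a b c d → a * 0ℚ * b * c * d ≡ 0ℚ
    absorb = solve-∀ ℚ-ring

  W-zeroʳ : ∀ r₁ r₂ Q α β → r₂ < length β → W r₁ r₂ q Q (α , β) ≡ 0ℚ
  W-zeroʳ r₁ r₂ Q α β r₂<ℓ = begin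
    q ^ℕ (r₁ ℕ.* size β) * schurPS q α r₁ * schurPS q β r₂ * c * C
      ≡⟨ cong (λ s → q ^ℕ (r₁ ℕ.* size β) * schurPS q α r₁ * s * c * C) (schurPS-zero β r₂ r₂<ℓ) ⟩
    q ^ℕ (r₁ ℕ.* size β) * schurPS q α r₁ * 0ℚ * c * C
      ≡⟨ absorb (q ^ℕ (r₁ ℕ.* size β)) (schurPS q α r₁) c C ⟩
    0ℚ ∎
    where
    c = inv (((1ℚ - q ^ℕ (r₁ ℕ.+ r₂)) * inv (1ℚ - q)) ^ℕ (size α ℕ.+ size β))
    C = prodTo r₁ (λ i → prodTo r₂ (λ j → (1ℚ + Q * q ^ℤ ex (part α i) (part β j) j i)
                                          * inv (1ℚ + Q * q ^ℤ ex 0 0 j i)))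
    absorb : ∀ a b c d → a * b * 0ℚ * c * d ≡ 0ℚ
    absorb = solve-∀ ℚ-ring

  schurConst : ℕ → ℚ
  schurConst k = Π k (λ j → (q ^ℕ j) ^ℕ (j ∸ 1) * Π (j ∸ 1) (λ i → inv (1ℚ - q ^ℤ ex 0 0 j i)))

  crossConst : ℕ → ℕ → ℚ → ℚ
  crossConst r₁ r₂ Q = Π r₁ (λ i → Π r₂ (λ j → q ^ℕ j * inv (1ℚ + Q * q ^ℤ ex 0 0 j i)))

  W-scale : ℕ → ℕ → ℚ → ℕ → ℚ
  W-scale r₁ r₂ Q n = schurConst r₁ * schurConst r₂ * crossConst r₁ r₂ Q
                      * inv (((1ℚ - q ^ℕ (r₁ ℕ.+ r₂)) * inv (1ℚ - q)) ^ℕ n)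

  W-scale-suc : ∀ r₁ r₂ Q n → q ^ℕ (r₁ ℕ.+ r₂) ≢ 1ℚ →
                W-scale r₁ r₂ Q (suc n) * [ r₁ ℕ.+ r₂ ] q ≡ W-scale r₁ r₂ Q n
  W-scale-suc r₁ r₂ Q n q^r≢1 = begin
    K * inv (ρ * ρ ^ℕ n) * [ r ] q             ≡⟨ cong (λ c → K * c * [ r ] q) (inv-distrib-* ρ (ρ ^ℕ n)) ⟩
    K * (inv ρ * inv (ρ ^ℕ n)) * [ r ] q       ≡⟨ regroup K (inv ρ) (inv (ρ ^ℕ n)) ([ r ] q) ⟩
    K * inv (ρ ^ℕ n) * (inv ρ * [ r ] q)       ≡⟨ cong (K * inv (ρ ^ℕ n) *_) (qInt-inverse q r q^r≢1) ⟩
    K * inv (ρ ^ℕ n) * 1ℚ                      ≡⟨ ℚₚ.*-identityʳ (K * inv (ρ ^ℕ n)) ⟩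
    K * inv (ρ ^ℕ n)                           ∎
    where
    r = r₁ ℕ.+ r₂
    ρ = (1ℚ - q ^ℕ r) * inv (1ℚ - q)
    K = schurConst r₁ * schurConst r₂ * crossConst r₁ r₂ Q
    regroup : ∀ k a b c → k * (a * b) * c ≡ k * b * (a * c)
    regroup = solve-∀ ℚ-ring

module _ {q : ℚ} (q≢0 : q ≢ 0ℚ) where

  schurPS-Δ : ∀ α k → length α ≤ k → schurPS q α k ≡ schurConst q k * Δ k (coords q α)
  schurPS-Δ α k ℓ≤k = begin
    schurPS q α k
      ≡⟨ if-¬T (k ℕ.<ᵇ length α) (λ t → ℕₚ.≤⇒≯ ℓ≤k (ℕₚ.<ᵇ⇒< k (length α) t)) ⟩
    q ^ℕ nfun α * prodPairs k f
      ≡⟨ cong₂ _*_ (^-nfun q α k ℓ≤k) (prodPairs-Π k f) ⟩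
    Π k (λ j → (q ^ℕ a j) ^ℕ (j ∸ 1)) * Π k (λ j → Π (j ∸ 1) (λ i → f i j))
      ≡⟨ Π-distrib k (λ j → (q ^ℕ a j) ^ℕ (j ∸ 1)) (λ j → Π (j ∸ 1) (λ i → f i j)) ⟨
    Π k (λ j → (q ^ℕ a j) ^ℕ (j ∸ 1) * Π (j ∸ 1) (λ i → f i j))
      ≡⟨ Π-cong k (λ j _ → column j) ⟩
    Π k (λ j → c j * ω (j ∸ 1) x (x j))
      ≡⟨ Π-distrib k c (λ j → ω (j ∸ 1) x (x j)) ⟩
    schurConst q k * Δ k x
      ∎
    where
    a = part α
    x = coords q α
    d : ℕ → ℕ → ℚ
    d i j = inv (1ℚ - q ^ℤ ex 0 0 j i)
    f : ℕ → ℕ → ℚ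
    f i j = (1ℚ - q ^ℤ ex (a i) (a j) j i) * d i j
    c : ℕ → ℚ
    c j = (q ^ℕ j) ^ℕ (j ∸ 1) * Π (j ∸ 1) (λ i → d i j)
    regroup : ∀ A E B D → A * (E * B * D) ≡ A * B * D * E
    regroup = solve-∀ ℚ-ring
    column : ∀ j → (q ^ℕ a j) ^ℕ (j ∸ 1) * Π (j ∸ 1) (λ i → f i j) ≡ c j * ω (j ∸ 1) x (x j)
    column j = begin
      A ^ℕ n * Π n (λ i → f i j)
        ≡⟨ cong (A ^ℕ n *_) (Π-cong n (λ i _ → cong (_* d i j) (1-^ℤ-ex q≢0 (a i) (a j) i j))) ⟩
      A ^ℕ n * Π n (λ i → (x j - x i) * B * d i j)
        ≡⟨ cong (A ^ℕ n *_) (Π-distrib n (λ i → (x j - x i) * B) (λ i → d i j)) ⟩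
      A ^ℕ n * (Π n (λ i → (x j - x i) * B) * D)
        ≡⟨ cong (λ p → A ^ℕ n * (p * D))
                (trans (Π-distrib n (λ i → x j - x i) (λ _ → B)) (cong (E *_) (Π-const n B))) ⟩
      A ^ℕ n * (E * B ^ℕ n * D)
        ≡⟨ regroup (A ^ℕ n) E (B ^ℕ n) D ⟩
      A ^ℕ n * B ^ℕ n * D * E
        ≡⟨ cong (λ p → p * D * E)
                (trans (sym (^-distribʳ-* A B n)) (cong (_^ℕ n) (^-inv-coord q≢0 (a j) j))) ⟩
      (q ^ℕ j) ^ℕ n * D * E
        ∎
      where
      n = j ∸ 1
      A = q ^ℕ a j
      B = inv (x j)
      D = Π n (λ i → d i j)
      E = ω n x (x j)

  cross-Π : ∀ r₁ r₂ Q α β → length β ≤ r₂ →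
    q ^ℕ (r₁ ℕ.* size β) * prodTo r₁ (λ i → prodTo r₂ (λ j →
        (1ℚ + Q * q ^ℤ ex (part α i) (part β j) j i) * inv (1ℚ + Q * q ^ℤ ex 0 0 j i)))
    ≡ crossConst q r₁ r₂ Q * Π r₁ (λ i → Π r₂ (λ j → coords q β j + Q * coords q α i))
  cross-Π r₁ r₂ Q α β ℓ≤r₂ = begin
    q ^ℕ (r₁ ℕ.* size β) * prodTo r₁ (λ i → prodTo r₂ (h i))
      ≡⟨ cong₂ _*_ q^rs (trans (prodTo-Π r₁ _) (Π-cong r₁ (λ i _ → prodTo-Π r₂ (h i)))) ⟩
    Π r₁ (λ _ → Π r₂ (λ j → q ^ℕ part β j)) * Π r₁ (λ i → Π r₂ (h i))
      ≡⟨ Π²-distrib r₁ r₂ (λ _ j → q ^ℕ part β j) h ⟨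
    Π r₁ (λ i → Π r₂ (λ j → q ^ℕ part β j * h i j))
      ≡⟨ Π-cong r₁ (λ i _ → Π-cong r₂ (λ j _ → entry i j)) ⟩
    Π r₁ (λ i → Π r₂ (λ j → (q ^ℕ j * e i j) * (y j + Q * x i)))
      ≡⟨ Π²-distrib r₁ r₂ (λ i j → q ^ℕ j * e i j) (λ i j → y j + Q * x i) ⟩
    crossConst q r₁ r₂ Q * Π r₁ (λ i → Π r₂ (λ j → y j + Q * x i))
      ∎
    where
    x = coords q α
    y = coords q β
    e : ℕ → ℕ → ℚ
    e i j = inv (1ℚ + Q * q ^ℤ ex 0 0 j i)
    h : ℕ → ℕ → ℚ
    h i j = (1ℚ + Q * q ^ℤ ex (part α i) (part β j) j i) * e i j
    q^rs : q ^ℕ (r₁ ℕ.* size β) ≡ Π r₁ (λ _ → Π r₂ (λ j → q ^ℕ part β j))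
    q^rs = begin
      q ^ℕ (r₁ ℕ.* size β)     ≡⟨ cong (q ^ℕ_) (ℕₚ.*-comm r₁ (size β)) ⟩
      q ^ℕ (size β ℕ.* r₁)     ≡⟨ ^-*-assoc q (size β) r₁ ⟨
      (q ^ℕ size β) ^ℕ r₁      ≡⟨ Π-const r₁ (q ^ℕ size β) ⟨
      Π r₁ (λ _ → q ^ℕ size β) ≡⟨ Π-cong r₁ (λ _ _ → ^-size q β r₂ ℓ≤r₂) ⟩
      Π r₁ (λ _ → Π r₂ (λ j → q ^ℕ part β j)) ∎
    regroup : ∀ b u v Q w e → b * ((v + Q * u) * w * e) ≡ b * w * e * (v + Q * u)
    regroup = solve-∀ ℚ-ring
    entry : ∀ i j → q ^ℕ part β j * h i j ≡ (q ^ℕ j * e i j) * (y j + Q * x i)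
    entry i j = begin
      q ^ℕ part β j * ((1ℚ + Q * q ^ℤ ex (part α i) (part β j) j i) * e i j)
        ≡⟨ cong (λ o → q ^ℕ part β j * (o * e i j)) (1+Q^ℤ-ex q≢0 Q (part α i) (part β j) i j) ⟩
      q ^ℕ part β j * ((y j + Q * x i) * inv (y j) * e i j)
        ≡⟨ regroup (q ^ℕ part β j) (x i) (y j) Q (inv (y j)) (e i j) ⟩
      q ^ℕ part β j * inv (y j) * e i j * (y j + Q * x i)
        ≡⟨ cong (λ p → p * e i j * (y j + Q * x i)) (^-inv-coord q≢0 (part β j) j) ⟩
      q ^ℕ j * e i j * (y j + Q * x i)
        ∎

  W-Δ₂ : ∀ r₁ r₂ Q α β → length α ≤ r₁ → length β ≤ r₂ →
    W r₁ r₂ q Q (α , β) ≡ W-scale q r₁ r₂ Q (size α ℕ.+ size β) * Δ₂ r₁ r₂ Q (coords q α) (coords q β)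
  W-Δ₂ r₁ r₂ Q α β ℓα≤r₁ ℓβ≤r₂ = begin
    q^ * schurPS q α r₁ * schurPS q β r₂ * c * C
      ≡⟨ cong₂ (λ s t → q^ * s * t * c * C) (schurPS-Δ α r₁ ℓα≤r₁) (schurPS-Δ β r₂ ℓβ≤r₂) ⟩
    q^ * (Kα * Δ r₁ x) * (Kβ * Δ r₂ y) * c * C
      ≡⟨ regroup q^ Kα (Δ r₁ x) Kβ (Δ r₂ y) c C ⟩
    Kα * Kβ * c * Δ r₁ x * Δ r₂ y * (q^ * C)
      ≡⟨ cong (Kα * Kβ * c * Δ r₁ x * Δ r₂ y *_) (cross-Π r₁ r₂ Q α β ℓβ≤r₂) ⟩
    Kα * Kβ * c * Δ r₁ x * Δ r₂ y * (crossConst q r₁ r₂ Q * Cr)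
      ≡⟨ regroup′ Kα Kβ c (Δ r₁ x) (Δ r₂ y) (crossConst q r₁ r₂ Q) Cr ⟩
    W-scale q r₁ r₂ Q (size α ℕ.+ size β) * Δ₂ r₁ r₂ Q x y
      ∎
    where
    x = coords q α
    y = coords q β
    q^ = q ^ℕ (r₁ ℕ.* size β)
    Kα = schurConst q r₁
    Kβ = schurConst q r₂
    c = inv (((1ℚ - q ^ℕ (r₁ ℕ.+ r₂)) * inv (1ℚ - q)) ^ℕ (size α ℕ.+ size β))
    C = prodTo r₁ (λ i → prodTo r₂ (λ j → (1ℚ + Q * q ^ℤ ex (part α i) (part β j) j i)
                                          * inv (1ℚ + Q * q ^ℤ ex 0 0 j i)))
    Cr = Π r₁ (λ i → Π r₂ (λ j → y j + Q * x i))
    regroup : ∀ p a X b Y c C → p * (a * X) * (b * Y) * c * C ≡ a * b * c * X * Y * (p * C)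
    regroup = solve-∀ ℚ-ring
    regroup′ : ∀ a b c X Y k C → a * b * c * X * Y * (k * C) ≡ a * b * k * c * (X * Y * C)
    regroup′ = solve-∀ ℚ-ring

-- The box recursion

module _ (r₁ r₂ : ℕ) {q : ℚ} (Q : ℚ) where

  W-addBox₂-long : ∀ α β → r₁ < length α ⊎ r₂ < length β →
                   W r₁ r₂ q Q (α , β) ≡ sumℚ (map (W r₁ r₂ q Q) (addBox₂ (α , β)))
  W-addBox₂-long α β long = begin
    W r₁ r₂ q Q (α , β)
      ≡⟨ vanish α β ℕₚ.≤-refl ℕₚ.≤-refl ⟩
    0ℚ + 0ℚ
      ≡⟨ cong₂ _+_
           (sumℚ-addBox-vanish (λ γ → W r₁ r₂ q Q (γ , β)) α
             (λ i → vanish (incAt α i) β (length-incAt-≥ α i) ℕₚ.≤-refl))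
           (sumℚ-addBox-vanish (λ η → W r₁ r₂ q Q (α , η)) β
             (λ j → vanish α (incAt β j) ℕₚ.≤-refl (length-incAt-≥ β j))) ⟨
    sumℚ (map (λ γ → W r₁ r₂ q Q (γ , β)) (addBox α)) + sumℚ (map (λ η → W r₁ r₂ q Q (α , η)) (addBox β))
      ≡⟨ sumℚ-addBox₂ (W r₁ r₂ q Q) α β ⟨
    sumℚ (map (W r₁ r₂ q Q) (addBox₂ (α , β)))
      ∎
    where
    vanish : ∀ γ η → length α ≤ length γ → length β ≤ length η → W r₁ r₂ q Q (γ , η) ≡ 0ℚ
    vanish γ η ℓα≤ℓγ ℓβ≤ℓη = [ (λ r₁<ℓα → W-zeroˡ q r₁ r₂ Q γ η (ℕₚ.<-≤-trans r₁<ℓα ℓα≤ℓγ))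
                             , (λ r₂<ℓβ → W-zeroʳ q r₁ r₂ Q γ η (ℕₚ.<-≤-trans r₂<ℓβ ℓβ≤ℓη)) ]′ long

module _ (r₁ r₂ : ℕ) {q : ℚ} (Q : ℚ) (q≢0 : q ≢ 0ℚ) where

  sumℚ-addBoxˡ : ∀ {α} β → Linked ℕ._≥_ α → length α ≤ r₁ → length β ≤ r₂ →
    sumℚ (map (λ γ → W r₁ r₂ q Q (γ , β)) (addBox α))
    ≡ Σ r₁ (λ i → W-scale q r₁ r₂ Q (suc (size α ℕ.+ size β)) * Δ₂ r₁ r₂ Q (qShift q i (coords q α)) (coords q β))
  sumℚ-addBoxˡ {α} β linked ℓα≤r₁ ℓβ≤r₂ =
    Σ-addBox _ _ α linked (λ γ r₁<ℓγ → W-zeroˡ q r₁ r₂ Q γ β r₁<ℓγ) added repeated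
    where
    S = W-scale q r₁ r₂ Q (suc (size α ℕ.+ size β))
    added : ∀ i → i ∈[1, r₁ ] → canAdd α i ≡ true →
            W r₁ r₂ q Q (incAt α i , β) ≡ S * Δ₂ r₁ r₂ Q (qShift q i (coords q α)) (coords q β)
    added i (1≤i , i≤r₁) addable = begin
      W r₁ r₂ q Q (incAt α i , β)
        ≡⟨ W-Δ₂ q≢0 r₁ r₂ Q (incAt α i) β (length-incAt-≤ α 1≤i ℓα≤r₁ i≤r₁) ℓβ≤r₂ ⟩
      W-scale q r₁ r₂ Q (size (incAt α i) ℕ.+ size β) * Δ₂ r₁ r₂ Q (coords q (incAt α i)) (coords q β)
        ≡⟨ cong₂ (λ n d → W-scale q r₁ r₂ Q (n ℕ.+ size β) * d) (size-incAt α 1≤i i≤ℓ+1)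
                 (Δ₂-congˡ r₁ r₂ Q (coords q β) (coords-incAt q α 1≤i i≤ℓ+1)) ⟩
      S * Δ₂ r₁ r₂ Q (qShift q i (coords q α)) (coords q β)
        ∎
      where
      i≤ℓ+1 = canAdd-bounded α addable
    repeated : ∀ i → 2 ≤ i → i ≤ r₁ → part α (i ∸ 1) ≡ part α i →
               S * Δ₂ r₁ r₂ Q (qShift q i (coords q α)) (coords q β) ≡ 0ℚ
    repeated i 2≤i i≤r₁ rep = begin
      S * (Δ r₁ (qShift q i (coords q α)) * Δ r₂ (coords q β) * C)
        ≡⟨ cong (λ d → S * (d * Δ r₂ (coords q β) * C)) (Δ-qShift-repeated q≢0 r₁ α 2≤i i≤r₁ rep) ⟩
      S * (0ℚ * Δ r₂ (coords q β) * C)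
        ≡⟨ absorb S (Δ r₂ (coords q β)) C ⟩
      0ℚ ∎
      where
      C = Π r₁ (λ i′ → Π r₂ (λ j → coords q β j + Q * qShift q i (coords q α) i′))
      absorb : ∀ s b c → s * (0ℚ * b * c) ≡ 0ℚ
      absorb = solve-∀ ℚ-ring

  sumℚ-addBoxʳ : ∀ α {β} → Linked ℕ._≥_ β → length α ≤ r₁ → length β ≤ r₂ →
    sumℚ (map (λ η → W r₁ r₂ q Q (α , η)) (addBox β))
    ≡ Σ r₂ (λ j → W-scale q r₁ r₂ Q (suc (size α ℕ.+ size β)) * Δ₂ r₁ r₂ Q (coords q α) (qShift q j (coords q β)))
  sumℚ-addBoxʳ α {β} linked ℓα≤r₁ ℓβ≤r₂ =
    Σ-addBox _ _ β linked (λ η r₂<ℓη → W-zeroʳ q r₁ r₂ Q α η r₂<ℓη) added repeated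
    where
    S = W-scale q r₁ r₂ Q (suc (size α ℕ.+ size β))
    added : ∀ j → j ∈[1, r₂ ] → canAdd β j ≡ true →
            W r₁ r₂ q Q (α , incAt β j) ≡ S * Δ₂ r₁ r₂ Q (coords q α) (qShift q j (coords q β))
    added j (1≤j , j≤r₂) addable = begin
      W r₁ r₂ q Q (α , incAt β j)
        ≡⟨ W-Δ₂ q≢0 r₁ r₂ Q α (incAt β j) ℓα≤r₁ (length-incAt-≤ β 1≤j ℓβ≤r₂ j≤r₂) ⟩
      W-scale q r₁ r₂ Q (size α ℕ.+ size (incAt β j)) * Δ₂ r₁ r₂ Q (coords q α) (coords q (incAt β j))
        ≡⟨ cong₂ (λ n d → W-scale q r₁ r₂ Q n * d)
                 (trans (cong (size α ℕ.+_) (size-incAt β 1≤j j≤ℓ+1)) (ℕₚ.+-suc (size α) (size β)))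
                 (Δ₂-congʳ r₁ r₂ Q (coords q α) (coords-incAt q β 1≤j j≤ℓ+1)) ⟩
      S * Δ₂ r₁ r₂ Q (coords q α) (qShift q j (coords q β))
        ∎
      where
      j≤ℓ+1 = canAdd-bounded β addable
    repeated : ∀ j → 2 ≤ j → j ≤ r₂ → part β (j ∸ 1) ≡ part β j →
               S * Δ₂ r₁ r₂ Q (coords q α) (qShift q j (coords q β)) ≡ 0ℚ
    repeated j 2≤j j≤r₂ rep = begin
      S * (Δ r₁ (coords q α) * Δ r₂ (qShift q j (coords q β)) * C)
        ≡⟨ cong (λ d → S * (Δ r₁ (coords q α) * d * C)) (Δ-qShift-repeated q≢0 r₂ β 2≤j j≤r₂ rep) ⟩
      S * (Δ r₁ (coords q α) * 0ℚ * C)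
        ≡⟨ absorb S (Δ r₁ (coords q α)) C ⟩
      0ℚ ∎
      where
      C = Π r₁ (λ i → Π r₂ (λ j′ → qShift q j (coords q β) j′ + Q * coords q α i))
      absorb : ∀ s a c → s * (a * 0ℚ * c) ≡ 0ℚ
      absorb = solve-∀ ℚ-ring

  W-addBox₂ : ∀ {α β} → Linked ℕ._≥_ α → Linked ℕ._≥_ β → length α ≤ r₁ → length β ≤ r₂ →
              q ^ℕ (r₁ ℕ.+ r₂) ≢ 1ℚ → W r₁ r₂ q Q (α , β) ≡ sumℚ (map (W r₁ r₂ q Q) (addBox₂ (α , β)))
  W-addBox₂ {α} {β} α-linked β-linked ℓα≤r₁ ℓβ≤r₂ q^r≢1 = sym (begin
    sumℚ (map (W r₁ r₂ q Q) (addBox₂ (α , β)))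
      ≡⟨ sumℚ-addBox₂ (W r₁ r₂ q Q) α β ⟩
    sumℚ (map (λ γ → W r₁ r₂ q Q (γ , β)) (addBox α)) + sumℚ (map (λ η → W r₁ r₂ q Q (α , η)) (addBox β))
      ≡⟨ cong₂ _+_ (sumℚ-addBoxˡ β α-linked ℓα≤r₁ ℓβ≤r₂) (sumℚ-addBoxʳ α β-linked ℓα≤r₁ ℓβ≤r₂) ⟩
    Σ r₁ (λ i → S * Δ₂ r₁ r₂ Q (qShift q i x) y) + Σ r₂ (λ j → S * Δ₂ r₁ r₂ Q x (qShift q j y))
      ≡⟨ cong₂ _+_ (*-distribˡ-Σ r₁ S _) (*-distribˡ-Σ r₂ S _) ⟨
    S * Σ r₁ (λ i → Δ₂ r₁ r₂ Q (qShift q i x) y) + S * Σ r₂ (λ j → Δ₂ r₁ r₂ Q x (qShift q j y))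
      ≡⟨ ℚₚ.*-distribˡ-+ S _ _ ⟨
    S * (Σ r₁ (λ i → Δ₂ r₁ r₂ Q (qShift q i x) y) + Σ r₂ (λ j → Δ₂ r₁ r₂ Q x (qShift q j y)))
      ≡⟨ cong (S *_) (Σ-Δ₂-qShift r₁ r₂ Q q x y) ⟩
    S * ([ r₁ ℕ.+ r₂ ] q * Δ₂ r₁ r₂ Q x y)
      ≡⟨ ℚₚ.*-assoc S ([ r₁ ℕ.+ r₂ ] q) (Δ₂ r₁ r₂ Q x y) ⟨
    S * [ r₁ ℕ.+ r₂ ] q * Δ₂ r₁ r₂ Q x y
      ≡⟨ cong (_* Δ₂ r₁ r₂ Q x y) (W-scale-suc q r₁ r₂ Q (size α ℕ.+ size β) q^r≢1) ⟩
    W-scale q r₁ r₂ Q (size α ℕ.+ size β) * Δ₂ r₁ r₂ Q x y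
      ≡⟨ W-Δ₂ q≢0 r₁ r₂ Q α β ℓα≤r₁ ℓβ≤r₂ ⟨
    W r₁ r₂ q Q (α , β)
      ∎)
    where
    x = coords q α
    y = coords q β
    S = W-scale q r₁ r₂ Q (suc (size α ℕ.+ size β))

lemma5p1 : (r₁ r₂ : ℕ) → 1 ≤ r₁ → 1 ≤ r₂ → (q Q : ℚ)
    → q ≢ 0ℚ
    → (∀ (m : ℕ) → 1 ≤ m → m ≤ r₁ ℕ.+ r₂ → q ^ℕ m ≢ 1ℚ)
    → (∀ (d : ℤ) → ℤ.- (ℤ.+ r₁) ℤ.< d → d ℤ.< ℤ.+ r₂ → 1ℚ + Q * (q ^ℤ d) ≢ 0ℚ)
    → (αβ : List ℕ × List ℕ) → IsDoublePartition αβ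
    → W r₁ r₂ q Q αβ ≡ sumℚ (map (W r₁ r₂ q Q) (addBox₂ αβ))
-- Only q ≢ 0 and q^(r₁ + r₂) ≢ 1 are used: the factors 1 + Q q^(j − i) in the denominators are
-- the same in every term (crossConst), so whether they vanish is irrelevant, and 1 ≤ r₁ only
-- makes m = r₁ + r₂ an admissible instance of the hypothesis on q^m.
lemma5p1 r₁ r₂ 1≤r₁ _ q Q q≢0 q^m≢1 _ (α , β) ((α-linked , _) , (β-linked , _))
  with length α ℕ.≤? r₁ | length β ℕ.≤? r₂
... | yes ℓα≤r₁ | yes ℓβ≤r₂ =
  W-addBox₂ r₁ r₂ Q q≢0 α-linked β-linked ℓα≤r₁ ℓβ≤r₂
    (q^m≢1 (r₁ ℕ.+ r₂) (ℕₚ.≤-trans 1≤r₁ (ℕₚ.m≤m+n r₁ r₂)) ℕₚ.≤-refl)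
... | no ℓα≰r₁ | _         = W-addBox₂-long r₁ r₂ Q α β (inj₁ (ℕₚ.≰⇒> ℓα≰r₁))
... | yes _    | no ℓβ≰r₂  = W-addBox₂-long r₁ r₂ Q α β (inj₂ (ℕₚ.≰⇒> ℓβ≰r₂))
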